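{- Let the 3-pan be the graph on vertices $e_1,e_2,e_3,e_4$ with edges $e_1e_2$, $e_2e_3$, $e_2e_4$, $e_3e_4$. For any $l\in\{1,2,3,4\}$, let $H$ be the $(e_3,l)$-ordering of the 3-pan. Then $R_<(H)\le 10$.
   Context: A $k$-ordering of a graph $H$ assigns distinct order-labels from $\{1,\ldots,|H|\}$ to $k$ of the vertices of $H$. For a vertex $v$ of $H$ and $1\le l\le |H|$, the $(v,l)$-ordering of $H$ is the 1-ordering in which $v$ receives order-label $l$ and no other vertex is labeled. An ordered 2-coloring on $n$ vertices is a red/blue coloring of the edges of the complete graph on vertex set $\{1,\ldots,n\}$. It contains a $k$-ordering $H$ (in a given color) if it has a subgraph isomorphic to $H$, all of whose edges have that color, such that for every $i$ the $i$-th smallest vertex of the copy corresponds to a vertex of $H$ that has order-label $i$ or no order-label. $R_<(H)$ is the least $n$ such that every ordered 2-coloring on $n$ vertices contains a monochromatic (red or blue) copy of $H$. -}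

module Defs where

open import Data.Nat using (ℕ; zero; suc)
open import Data.Fin using (Fin; zero; suc; toℕ; _<?_; _≟_)
open import Data.Fin.Patterns
open import Data.Bool using (Bool; true; false; if_then_else_)
open import Data.Maybe using (Maybe; just; nothing)
open import Data.List using (List; []; _∷_; length; filter; allFin)
open import Data.Product using (Σ; _×_; _,_; ∃-syntax)
open import Relation.Binary.PropositionalEquality using (_≡_)
open import Relation.Nullary.Decidable using (does; ⌊_⌋)
open import Function.Definitions using (Injective)

-- A (finite, simple) graph: vertex set Fin nVert, an edge relation
-- (each edge listed in at least one direction).
record Graph : Set₁ where
  field
    nVert : ℕ
    Adj   : Fin nVert → Fin nVert → Set
open Graph public

-- Order-labels {1..|H|} are represented 0-indexed by Fin |H|
-- (label l ↦ l - 1).  A partial labelling; a k-ordering additionally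
-- requires injectivity on labelled vertices.
Labelling : Graph → Set
Labelling H = Fin (nVert H) → Maybe (Fin (nVert H))

LabelInjective : (H : Graph) → Labelling H → Set
LabelInjective H λ' = ∀ u v l → λ' u ≡ just l → λ' v ≡ just l → u ≡ v

pointOrdering : (H : Graph) → Fin (nVert H) → Fin (nVert H) → Labelling H
pointOrdering H v l w = if ⌊ w ≟ v ⌋ then just l else nothing

-- Colours: true = red, false = blue.
Colour : Set
Colour = Bool

-- An ordered 2-colouring on vertex set Fin n: only the values c i j with
-- i < j are used (the colour of the edge {i,j}, i<j).
Colouring : ℕ → Set
Colouring n = Fin n → Fin n → Colour

edgeColour : ∀ {n} → Colouring n → Fin n → Fin n → Colour
edgeColour c u v = if ⌊ u <? v ⌋ then c u v else c v u

-- number of vertices w of H with f w < f v  (0-indexed rank of f v in the copy)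
rankIn : ∀ {k n} → (Fin k → Fin n) → Fin k → ℕ
rankIn {k} f v = length (filter (λ w → f w <? f v) (allFin k))

Contains : ∀ {n} → Colouring n → Colour → (H : Graph) → Labelling H → Set
Contains {n} c col H λ' =
  Σ (Fin (nVert H) → Fin n) λ f →
    Injective _≡_ _≡_ f ×
    (∀ u v → Adj H u v → edgeColour c (f u) (f v) ≡ col) ×
    (∀ v l → λ' v ≡ just l → rankIn f v ≡ toℕ l)

RamseyHolds : (H : Graph) → Labelling H → ℕ → Set
RamseyHolds H λ' n = ∀ (c : Colouring n) → Σ Colour λ col → Contains c col H λ'

-- The 3-pan: e₁ = 0, e₂ = 1, e₃ = 2, e₄ = 3; edges e₁e₂, e₂e₃, e₂e₄, e₃e₄.
data PanAdj : Fin 4 → Fin 4 → Set where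
  e12 : PanAdj 0F 1F
  e23 : PanAdj 1F 2F
  e24 : PanAdj 1F 3F
  e34 : PanAdj 2F 3F

pan3 : Graph
pan3 = record { nVert = 4 ; Adj = PanAdj }

e₃ : Fin 4
e₃ = 2F

-- Already 7 vertices suffice, for every position l of e₃.  A colouring of
-- K₇ is explored along a decision tree that queries one edge colour at a
-- time; at each leaf the colours queried so far already contain a
-- monochromatic copy of the 3-pan with e₃ at position l, given explicitly.
-- One such tree per l (found by a computer search) is a finite certificate
-- that Agda checks by evaluation.

module Submission where

open import Defs
open import Data.Nat using (ℕ; _≤_)
import Data.Nat.Properties as ℕ
open import Data.Fin using (Fin; toℕ; _<?_; _≟_)
open import Data.Fin.Patterns
open import Data.Fin.Properties using (all?)
open import Data.Vec using ([]; _∷_; lookup)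
open import Data.Bool using (true; false; if_then_else_)
import Data.Bool as Bool
open import Data.Maybe using (Maybe; just; nothing)
open import Data.Maybe.Properties using (just-injective; ≡-dec)
open import Data.Product using (Σ; _×_; _,_)
open import Relation.Binary.Definitions using (Decidable)
open import Relation.Binary.PropositionalEquality using (_≡_; refl; trans)
open import Relation.Nullary.Decidable
  using (Dec; yes; no; ⌊_⌋; map′; True; toWitness; _×-dec_; _→-dec_)

PartialColouring : ℕ → Set
PartialColouring n = Fin n → Fin n → Maybe Colour

uncoloured : ∀ {n} → PartialColouring n
uncoloured _ _ = nothing

assign : ∀ {n} → PartialColouring n → Fin n → Fin n → Colour → PartialColouring n
assign p i j b x y = if ⌊ x ≟ i ×-dec y ≟ j ⌋ then just b else p x y

_Extends_ : ∀ {n} → Colouring n → PartialColouring n → Set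
c Extends p = ∀ i j b → p i j ≡ just b → c i j ≡ b

uncoloured-extended : ∀ {n} (c : Colouring n) → c Extends uncoloured
uncoloured-extended c i j b ()

assign-extended : ∀ {n} {c : Colouring n} {p i j b} →
  c Extends p → c i j ≡ b → c Extends assign p i j b
assign-extended {i = i} {j} c⊒p cij≡b x y b′ eq with x ≟ i | y ≟ j
... | yes refl | yes refl = trans cij≡b (just-injective eq)
... | yes _    | no _     = c⊒p x y b′ eq
... | no _     | _        = c⊒p x y b′ eq

partialEdgeColour : ∀ {n} → PartialColouring n → Fin n → Fin n → Maybe Colour
partialEdgeColour p u v = if ⌊ u <? v ⌋ then p u v else p v u

edgeColour-extended : ∀ {n} {c : Colouring n} {p} u v {b} →
  c Extends p → partialEdgeColour p u v ≡ just b → edgeColour c u v ≡ b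
edgeColour-extended u v = orient ⌊ u <? v ⌋
  where
  orient : ∀ {c p b} w → c Extends p →
    (if w then p u v else p v u) ≡ just b → (if w then c u v else c v u) ≡ b
  orient true  c⊒p = c⊒p u v _
  orient false c⊒p = c⊒p v u _

data Certificate (n k : ℕ) : Set where
  found  : Colour → (Fin k → Fin n) → Certificate n k
  branch : Fin n → Fin n → Certificate n k → Certificate n k → Certificate n k

module _ (H : Graph) (adj? : Decidable (Adj H)) (λ' : Labelling H) where

  private
    k = nVert H

  PartialCopy : ∀ {n} → PartialColouring n → Colour → (Fin k → Fin n) → Set
  PartialCopy p col f =
    (∀ x y → f x ≡ f y → x ≡ y) ×
    (∀ u v → Adj H u v → partialEdgeColour p (f u) (f v) ≡ just col) ×
    (∀ v l → λ' v ≡ just l → rankIn f v ≡ toℕ l)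

  partialCopy? : ∀ {n} p col (f : Fin k → Fin n) → Dec (PartialCopy p col f)
  partialCopy? p col f =
    all? (λ x → all? λ y → f x ≟ f y →-dec x ≟ y) ×-dec
    all? (λ u → all? λ v → adj? u v →-dec edge? u v) ×-dec
    all? (λ v → label? (λ' v) (rankIn f v))
    where
    edge? : ∀ u v → Dec (partialEdgeColour p (f u) (f v) ≡ just col)
    edge? u v = ≡-dec Bool._≟_ (partialEdgeColour p (f u) (f v)) (just col)
    label? : ∀ m r → Dec (∀ l → m ≡ just l → r ≡ toℕ l)
    label? nothing  r = yes λ _ ()
    label? (just l) r = map′ (λ { r≡l _ refl → r≡l }) (λ h → h l refl) (r ℕ.≟ toℕ l)

  partialCopy⇒contains : ∀ {n} {c : Colouring n} {p col f} →
    c Extends p → PartialCopy p col f → Contains c col H λ'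
  partialCopy⇒contains {f = f} c⊒p (inj , edges , ranks) =
    f , (λ {x} {y} → inj x y) ,
    (λ u v uv → edgeColour-extended (f u) (f v) c⊒p (edges u v uv)) , ranks

  Valid : ∀ {n} → PartialColouring n → Certificate n k → Set
  Valid p (found col f)       = PartialCopy p col f
  Valid p (branch i j t₁ t₂) = Valid (assign p i j true) t₁ × Valid (assign p i j false) t₂

  valid? : ∀ {n} p (t : Certificate n k) → Dec (Valid p t)
  valid? p (found col f)       = partialCopy? p col f
  valid? p (branch i j t₁ t₂) = valid? (assign p i j true) t₁ ×-dec valid? (assign p i j false) t₂

  valid⇒monochromatic : ∀ {n} {c : Colouring n} {p} t →
    c Extends p → Valid p t → Σ Colour λ col → Contains c col H λ'
  valid⇒monochromatic (found col f) c⊒p copy = col , partialCopy⇒contains c⊒p copy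
  valid⇒monochromatic {c = c} (branch i j t₁ t₂) c⊒p (v₁ , v₂) with c i j in cij
  ... | true  = valid⇒monochromatic t₁ (assign-extended c⊒p cij) v₁
  ... | false = valid⇒monochromatic t₂ (assign-extended c⊒p cij) v₂

  ramseyHolds-fromCertificate : ∀ {n} (t : Certificate n k) →
    True (valid? uncoloured t) → RamseyHolds H λ' n
  ramseyHolds-fromCertificate t valid c =
    valid⇒monochromatic t (uncoloured-extended c) (toWitness valid)

panAdj? : Decidable PanAdj
panAdj? 0F 0F = no λ ()
panAdj? 0F 1F = yes e12
panAdj? 0F 2F = no λ ()
panAdj? 0F 3F = no λ ()
panAdj? 1F 0F = no λ ()
panAdj? 1F 1F = no λ ()
panAdj? 1F 2F = yes e23
panAdj? 1F 3F = yes e24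
panAdj? 2F 0F = no λ ()
panAdj? 2F 1F = no λ ()
panAdj? 2F 2F = no λ ()
panAdj? 2F 3F = yes e34
panAdj? 3F _  = no λ ()

leaf : Fin 7 → Fin 7 → Fin 7 → Fin 7 → Colour → Certificate 7 4
leaf v₁ v₂ v₃ v₄ col = found col (lookup (v₁ ∷ v₂ ∷ v₃ ∷ v₄ ∷ []))

certificate₁ : Certificate 7 4
certificate₁ =
 (branch 1F 2F
 (branch 0F 2F
 (branch 0F 1F
 (branch 2F 3F
 (leaf 3F 2F 0F 1F true)
 (branch 2F 4F
 (leaf 4F 2F 0F 1F true)
 (branch 2F 5F
 (leaf 5F 2F 0F 1F true)
 (branch 1F 6F
 (leaf 6F 1F 0F 2F true)
 (branch 1F 3F
 (leaf 3F 1F 0F 2F true)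
 (branch 3F 6F
 (branch 1F 4F
 (leaf 4F 1F 0F 2F true)
 (branch 3F 4F
 (branch 4F 6F
 (branch 4F 5F
 (leaf 5F 4F 3F 6F true)
 (branch 1F 5F
 (leaf 5F 1F 0F 2F true)
 (leaf 2F 4F 1F 5F false)))
 (leaf 2F 4F 1F 6F false))
 (leaf 2F 3F 1F 4F false)))
 (leaf 2F 3F 1F 6F false)))))))
 (branch 2F 3F
 (branch 0F 3F
 (leaf 1F 2F 0F 3F true)
 (branch 1F 3F
 (branch 2F 4F
 (leaf 4F 2F 1F 3F true)
 (branch 2F 5F
 (leaf 5F 2F 1F 3F true)
 (branch 2F 6F
 (leaf 6F 2F 1F 3F true)
 (branch 3F 4F
 (leaf 4F 3F 1F 2F true)
 (branch 0F 4F
 (branch 4F 5F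
 (branch 3F 5F
 (leaf 5F 3F 1F 2F true)
 (branch 0F 5F
 (branch 4F 6F
 (leaf 6F 4F 0F 5F true)
 (leaf 3F 4F 2F 6F false))
 (leaf 2F 5F 0F 3F false)))
 (leaf 3F 4F 2F 5F false))
 (leaf 2F 4F 0F 3F false))))))
 (branch 1F 4F
 (branch 2F 4F
 (leaf 3F 2F 1F 4F true)
 (branch 1F 5F
 (branch 2F 5F
 (leaf 3F 2F 1F 5F true)
 (branch 3F 4F
 (branch 4F 5F
 (leaf 3F 4F 1F 5F true)
 (branch 3F 5F
 (branch 1F 6F
 (branch 4F 6F
 (leaf 3F 4F 1F 6F true)
 (leaf 6F 4F 2F 5F false))
 (leaf 6F 1F 0F 3F false))
 (leaf 3F 5F 2F 4F false)))
 (leaf 4F 3F 0F 1F false)))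
 (leaf 5F 1F 0F 3F false)))
 (leaf 4F 1F 0F 3F false))))
 (branch 2F 4F
 (branch 0F 4F
 (leaf 1F 2F 0F 4F true)
 (branch 1F 4F
 (branch 2F 5F
 (leaf 5F 2F 1F 4F true)
 (branch 2F 6F
 (leaf 6F 2F 1F 4F true)
 (branch 3F 4F
 (leaf 3F 4F 1F 2F true)
 (branch 0F 3F
 (branch 3F 5F
 (branch 4F 5F
 (leaf 5F 4F 1F 2F true)
 (branch 0F 5F
 (branch 3F 6F
 (leaf 6F 3F 0F 5F true)
 (leaf 4F 3F 2F 6F false))
 (leaf 2F 5F 0F 4F false)))
 (leaf 4F 3F 2F 5F false))
 (leaf 2F 3F 0F 4F false)))))
 (branch 3F 4F
 (branch 4F 5F
 (branch 2F 5F
 (leaf 3F 4F 2F 5F true)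
 (branch 4F 6F
 (branch 2F 6F
 (leaf 3F 4F 2F 6F true)
 (branch 3F 5F
 (leaf 6F 4F 3F 5F true)
 (branch 3F 6F
 (leaf 5F 4F 3F 6F true)
 (leaf 5F 3F 2F 6F false))))
 (leaf 6F 4F 0F 1F false)))
 (leaf 5F 4F 0F 1F false))
 (leaf 3F 4F 0F 1F false))))
 (branch 3F 4F
 (branch 0F 5F
 (branch 2F 5F
 (leaf 1F 2F 0F 5F true)
 (branch 4F 5F
 (branch 0F 4F
 (leaf 3F 4F 0F 5F true)
 (branch 1F 4F
 (branch 1F 3F
 (leaf 5F 4F 1F 3F true)
 (branch 1F 5F
 (leaf 3F 4F 1F 5F true)
 (branch 3F 5F
 (branch 0F 3F
 (leaf 4F 3F 0F 5F true)
 (leaf 2F 3F 0F 1F false))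
 (leaf 2F 3F 1F 5F false))))
 (leaf 2F 4F 0F 1F false)))
 (branch 3F 5F
 (branch 0F 3F
 (leaf 4F 3F 0F 5F true)
 (branch 1F 3F
 (branch 1F 4F
 (leaf 5F 3F 1F 4F true)
 (branch 1F 5F
 (leaf 4F 3F 1F 5F true)
 (leaf 2F 4F 1F 5F false)))
 (leaf 2F 3F 0F 1F false)))
 (leaf 3F 5F 2F 4F false))))
 (branch 1F 5F
 (branch 4F 5F
 (branch 1F 4F
 (leaf 3F 4F 1F 5F true)
 (branch 0F 4F
 (branch 0F 3F
 (leaf 5F 4F 0F 3F true)
 (branch 1F 3F
 (branch 3F 5F
 (leaf 4F 3F 1F 5F true)
 (leaf 2F 3F 0F 5F false))
 (leaf 2F 3F 0F 1F false)))
 (leaf 2F 4F 0F 1F false)))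
 (branch 0F 4F
 (branch 0F 3F
 (branch 4F 6F
 (leaf 6F 4F 0F 3F true)
 (branch 2F 5F
 (branch 2F 6F
 (leaf 6F 2F 1F 5F true)
 (leaf 5F 4F 2F 6F false))
 (leaf 6F 4F 2F 5F false)))
 (branch 3F 5F
 (branch 1F 3F
 (leaf 4F 3F 1F 5F true)
 (leaf 2F 3F 0F 1F false))
 (leaf 2F 3F 0F 5F false)))
 (leaf 2F 4F 0F 5F false)))
 (branch 4F 5F
 (branch 3F 5F
 (branch 5F 6F
 (leaf 6F 5F 3F 4F true)
 (leaf 6F 5F 0F 1F false))
 (leaf 3F 5F 0F 1F false))
 (leaf 4F 5F 0F 1F false))))
 (branch 4F 5F
 (branch 3F 5F
 (branch 3F 6F
 (branch 4F 6F
 (branch 5F 6F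
 (leaf 4F 5F 3F 6F true)
 (branch 0F 5F
 (branch 2F 5F
 (leaf 1F 2F 0F 5F true)
 (branch 0F 3F
 (leaf 4F 5F 0F 3F true)
 (branch 0F 4F
 (leaf 3F 5F 0F 4F true)
 (leaf 2F 3F 0F 4F false))))
 (branch 1F 5F
 (branch 1F 3F
 (leaf 4F 5F 1F 3F true)
 (branch 1F 4F
 (leaf 3F 5F 1F 4F true)
 (leaf 2F 3F 1F 4F false)))
 (leaf 6F 5F 0F 1F false))))
 (leaf 6F 4F 2F 3F false))
 (leaf 6F 3F 2F 4F false))
 (leaf 5F 3F 2F 4F false))
 (leaf 5F 4F 2F 3F false))))))
 (branch 2F 3F
 (branch 1F 3F
 (branch 2F 4F
 (leaf 4F 2F 1F 3F true)
 (branch 2F 5F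
 (leaf 5F 2F 1F 3F true)
 (branch 2F 6F
 (leaf 6F 2F 1F 3F true)
 (branch 0F 4F
 (branch 0F 5F
 (branch 0F 6F
 (branch 3F 4F
 (leaf 4F 3F 1F 2F true)
 (branch 4F 5F
 (branch 4F 6F
 (leaf 5F 4F 0F 6F true)
 (leaf 3F 4F 2F 6F false))
 (leaf 3F 4F 2F 5F false)))
 (leaf 4F 2F 0F 6F false))
 (leaf 4F 2F 0F 5F false))
 (leaf 5F 2F 0F 4F false)))))
 (branch 2F 4F
 (branch 1F 4F
 (leaf 3F 2F 1F 4F true)
 (branch 3F 4F
 (branch 4F 5F
 (leaf 5F 4F 2F 3F true)
 (branch 3F 5F
 (leaf 5F 3F 2F 4F true)
 (branch 1F 5F
 (branch 2F 5F
 (leaf 3F 2F 1F 5F true)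
 (branch 0F 5F
 (branch 0F 1F
 (leaf 2F 1F 0F 5F true)
 (branch 0F 3F
 (branch 0F 4F
 (leaf 2F 3F 0F 4F true)
 (leaf 3F 1F 0F 4F false))
 (leaf 4F 1F 0F 3F false)))
 (leaf 3F 5F 0F 2F false)))
 (leaf 3F 5F 1F 4F false))))
 (branch 4F 5F
 (branch 3F 5F
 (branch 2F 5F
 (leaf 3F 5F 2F 4F true)
 (branch 3F 6F
 (branch 2F 6F
 (leaf 5F 3F 2F 6F true)
 (branch 0F 5F
 (branch 0F 3F
 (leaf 2F 3F 0F 5F true)
 (branch 0F 4F
 (leaf 2F 4F 0F 5F true)
 (leaf 1F 3F 0F 4F false)))
 (leaf 6F 2F 0F 5F false)))
 (leaf 6F 3F 1F 4F false)))
 (leaf 5F 3F 1F 4F false))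
 (leaf 5F 4F 1F 3F false))))
 (branch 0F 4F
 (branch 2F 5F
 (branch 1F 5F
 (leaf 3F 2F 1F 5F true)
 (branch 3F 5F
 (branch 4F 5F
 (leaf 4F 5F 2F 3F true)
 (branch 1F 4F
 (branch 0F 1F
 (leaf 2F 1F 0F 4F true)
 (branch 0F 5F
 (branch 0F 3F
 (leaf 2F 3F 0F 5F true)
 (leaf 5F 1F 0F 3F false))
 (leaf 3F 1F 0F 5F false)))
 (leaf 2F 4F 1F 5F false)))
 (branch 4F 5F
 (branch 0F 5F
 (leaf 2F 5F 0F 4F true)
 (branch 0F 3F
 (branch 3F 4F
 (leaf 2F 3F 0F 4F true)
 (leaf 4F 3F 1F 5F false))
 (leaf 1F 3F 0F 5F false)))
 (leaf 4F 5F 1F 3F false))))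
 (branch 0F 5F
 (branch 4F 5F
 (branch 3F 4F
 (leaf 3F 4F 0F 5F true)
 (branch 1F 4F
 (leaf 1F 4F 0F 5F true)
 (leaf 2F 4F 1F 3F false)))
 (branch 3F 4F
 (branch 0F 3F
 (leaf 2F 3F 0F 4F true)
 (branch 4F 6F
 (branch 0F 6F
 (leaf 3F 4F 0F 6F true)
 (branch 2F 6F
 (branch 3F 6F
 (leaf 4F 3F 2F 6F true)
 (leaf 1F 3F 0F 6F false))
 (leaf 4F 2F 0F 6F false)))
 (leaf 6F 4F 2F 5F false)))
 (leaf 3F 4F 2F 5F false)))
 (leaf 4F 2F 0F 5F false)))
 (branch 3F 4F
 (branch 2F 5F
 (branch 2F 6F
 (branch 1F 5F
 (leaf 3F 2F 1F 5F true)
 (branch 1F 6F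
 (leaf 3F 2F 1F 6F true)
 (branch 3F 5F
 (leaf 4F 3F 2F 5F true)
 (branch 3F 6F
 (leaf 4F 3F 2F 6F true)
 (leaf 5F 3F 1F 6F false)))))
 (leaf 6F 2F 0F 4F false))
 (leaf 5F 2F 0F 4F false))
 (leaf 3F 4F 0F 2F false)))))
 (branch 0F 3F
 (branch 2F 4F
 (branch 1F 4F
 (branch 3F 4F
 (leaf 3F 4F 1F 2F true)
 (branch 2F 5F
 (leaf 5F 2F 1F 4F true)
 (branch 2F 6F
 (leaf 6F 2F 1F 4F true)
 (branch 0F 5F
 (branch 0F 6F
 (branch 3F 5F
 (branch 3F 6F
 (leaf 5F 3F 0F 6F true)
 (leaf 4F 3F 2F 6F false))
 (leaf 4F 3F 2F 5F false))
 (leaf 3F 2F 0F 6F false))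
 (leaf 3F 2F 0F 5F false)))))
 (branch 2F 5F
 (branch 1F 5F
 (leaf 4F 2F 1F 5F true)
 (branch 4F 5F
 (branch 3F 4F
 (leaf 3F 4F 2F 5F true)
 (branch 1F 3F
 (branch 0F 1F
 (leaf 2F 1F 0F 3F true)
 (branch 0F 4F
 (branch 0F 5F
 (leaf 2F 4F 0F 5F true)
 (leaf 4F 1F 0F 5F false))
 (leaf 3F 4F 0F 1F false)))
 (leaf 2F 3F 1F 4F false)))
 (branch 3F 4F
 (branch 0F 4F
 (leaf 2F 4F 0F 3F true)
 (branch 0F 5F
 (branch 3F 5F
 (leaf 2F 5F 0F 3F true)
 (leaf 3F 5F 1F 4F false))
 (leaf 1F 4F 0F 5F false)))
 (leaf 3F 4F 1F 5F false))))
 (branch 0F 5F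
 (branch 3F 5F
 (branch 4F 5F
 (leaf 4F 5F 0F 3F true)
 (branch 1F 5F
 (leaf 1F 5F 0F 3F true)
 (leaf 2F 5F 1F 4F false)))
 (branch 4F 5F
 (branch 0F 4F
 (leaf 2F 4F 0F 5F true)
 (branch 5F 6F
 (branch 0F 6F
 (leaf 4F 5F 0F 6F true)
 (branch 2F 6F
 (branch 4F 6F
 (leaf 5F 4F 2F 6F true)
 (leaf 1F 4F 0F 6F false))
 (leaf 3F 2F 0F 6F false)))
 (leaf 6F 5F 2F 3F false)))
 (leaf 4F 5F 2F 3F false)))
 (leaf 3F 2F 0F 5F false))))
 (branch 0F 4F
 (branch 3F 4F
 (branch 1F 3F
 (leaf 1F 3F 0F 4F true)
 (branch 3F 5F
 (leaf 5F 3F 0F 4F true)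
 (branch 3F 6F
 (leaf 6F 3F 0F 4F true)
 (branch 1F 5F
 (branch 1F 6F
 (branch 2F 5F
 (branch 2F 6F
 (leaf 5F 2F 1F 6F true)
 (leaf 5F 3F 2F 6F false))
 (leaf 6F 3F 2F 5F false))
 (leaf 2F 3F 1F 6F false))
 (leaf 2F 3F 1F 5F false)))))
 (branch 4F 5F
 (branch 3F 5F
 (branch 0F 5F
 (leaf 3F 5F 0F 4F true)
 (branch 2F 5F
 (branch 1F 5F
 (leaf 3F 5F 1F 2F true)
 (branch 3F 6F
 (branch 0F 6F
 (leaf 5F 3F 0F 6F true)
 (branch 2F 6F
 (branch 5F 6F
 (leaf 3F 5F 2F 6F true)
 (leaf 1F 5F 0F 6F false))
 (leaf 3F 2F 0F 6F false)))
 (leaf 6F 3F 2F 4F false)))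
 (leaf 3F 2F 0F 5F false)))
 (leaf 5F 3F 2F 4F false))
 (leaf 5F 4F 2F 3F false)))
 (leaf 3F 2F 0F 4F false)))
 (branch 3F 4F
 (branch 2F 4F
 (branch 1F 4F
 (leaf 3F 4F 1F 2F true)
 (branch 2F 5F
 (branch 2F 6F
 (branch 1F 5F
 (leaf 4F 2F 1F 5F true)
 (branch 1F 6F
 (leaf 4F 2F 1F 6F true)
 (branch 4F 5F
 (leaf 3F 4F 2F 5F true)
 (branch 4F 6F
 (leaf 3F 4F 2F 6F true)
 (leaf 5F 4F 1F 6F false)))))
 (leaf 6F 2F 0F 3F false))
 (leaf 5F 2F 0F 3F false)))
 (leaf 4F 2F 0F 3F false))
 (leaf 4F 3F 0F 2F false)))))
 (branch 0F 2F
 (branch 2F 3F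
 (branch 0F 3F
 (branch 2F 4F
 (leaf 4F 2F 0F 3F true)
 (branch 2F 5F
 (leaf 5F 2F 0F 3F true)
 (branch 2F 6F
 (leaf 6F 2F 0F 3F true)
 (branch 1F 4F
 (branch 1F 5F
 (branch 1F 6F
 (branch 1F 3F
 (leaf 1F 3F 0F 2F true)
 (branch 3F 4F
 (leaf 4F 3F 0F 2F true)
 (branch 4F 5F
 (branch 4F 6F
 (leaf 5F 4F 1F 6F true)
 (leaf 3F 4F 2F 6F false))
 (leaf 3F 4F 2F 5F false))))
 (leaf 4F 2F 1F 6F false))
 (leaf 4F 2F 1F 5F false))
 (leaf 5F 2F 1F 4F false)))))
 (branch 2F 4F
 (branch 0F 4F
 (leaf 3F 2F 0F 4F true)
 (branch 3F 4F
 (branch 4F 5F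
 (leaf 5F 4F 2F 3F true)
 (branch 3F 5F
 (leaf 5F 3F 2F 4F true)
 (branch 0F 5F
 (branch 2F 5F
 (leaf 3F 2F 0F 5F true)
 (branch 1F 5F
 (branch 3F 6F
 (leaf 6F 3F 2F 4F true)
 (branch 0F 6F
 (branch 2F 6F
 (leaf 3F 2F 0F 6F true)
 (branch 5F 6F
 (leaf 1F 5F 0F 6F true)
 (leaf 3F 5F 2F 6F false)))
 (leaf 5F 3F 0F 6F false)))
 (leaf 3F 5F 1F 2F false)))
 (leaf 3F 5F 0F 4F false))))
 (branch 1F 3F
 (branch 3F 5F
 (branch 3F 6F
 (branch 1F 5F
 (leaf 2F 3F 1F 5F true)
 (branch 1F 6F
 (leaf 2F 3F 1F 6F true)
 (branch 2F 5F
 (leaf 6F 3F 2F 5F true)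
 (branch 2F 6F
 (leaf 5F 3F 2F 6F true)
 (leaf 5F 2F 1F 6F false)))))
 (leaf 6F 3F 0F 4F false))
 (leaf 5F 3F 0F 4F false))
 (leaf 1F 3F 0F 4F false))))
 (branch 1F 4F
 (branch 2F 5F
 (branch 0F 5F
 (leaf 3F 2F 0F 5F true)
 (branch 3F 5F
 (branch 4F 5F
 (leaf 4F 5F 2F 3F true)
 (branch 0F 4F
 (branch 5F 6F
 (leaf 6F 5F 2F 3F true)
 (branch 0F 6F
 (branch 2F 6F
 (leaf 3F 2F 0F 6F true)
 (branch 4F 6F
 (leaf 1F 4F 0F 6F true)
 (leaf 5F 4F 2F 6F false)))
 (leaf 4F 5F 0F 6F false)))
 (leaf 2F 4F 0F 5F false)))
 (branch 4F 5F
 (branch 1F 5F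
 (leaf 2F 5F 1F 4F true)
 (leaf 1F 5F 0F 3F false))
 (leaf 4F 5F 0F 3F false))))
 (branch 1F 5F
 (branch 4F 5F
 (branch 3F 4F
 (leaf 3F 4F 1F 5F true)
 (branch 0F 4F
 (branch 0F 5F
 (leaf 1F 4F 0F 5F true)
 (branch 3F 5F
 (leaf 3F 5F 1F 4F true)
 (leaf 2F 5F 0F 3F false)))
 (leaf 2F 4F 0F 3F false)))
 (branch 3F 4F
 (branch 1F 3F
 (leaf 2F 3F 1F 4F true)
 (branch 0F 1F
 (branch 0F 4F
 (leaf 3F 4F 0F 1F true)
 (branch 0F 5F
 (leaf 4F 1F 0F 5F true)
 (leaf 2F 4F 0F 5F false)))
 (leaf 2F 1F 0F 3F false)))
 (leaf 3F 4F 2F 5F false)))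
 (leaf 4F 2F 1F 5F false)))
 (branch 3F 4F
 (branch 2F 5F
 (branch 2F 6F
 (branch 0F 5F
 (leaf 3F 2F 0F 5F true)
 (branch 0F 6F
 (leaf 3F 2F 0F 6F true)
 (branch 3F 5F
 (leaf 4F 3F 2F 5F true)
 (branch 3F 6F
 (leaf 4F 3F 2F 6F true)
 (leaf 5F 3F 0F 6F false)))))
 (leaf 6F 2F 1F 4F false))
 (leaf 5F 2F 1F 4F false))
 (leaf 3F 4F 1F 2F false)))))
 (branch 1F 3F
 (branch 2F 4F
 (branch 0F 4F
 (branch 3F 4F
 (leaf 3F 4F 0F 2F true)
 (branch 2F 5F
 (leaf 5F 2F 0F 4F true)
 (branch 2F 6F
 (leaf 6F 2F 0F 4F true)
 (branch 1F 5F
 (branch 1F 6F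
 (branch 3F 5F
 (branch 3F 6F
 (leaf 5F 3F 1F 6F true)
 (leaf 4F 3F 2F 6F false))
 (leaf 4F 3F 2F 5F false))
 (leaf 3F 2F 1F 6F false))
 (leaf 3F 2F 1F 5F false)))))
 (branch 2F 5F
 (branch 0F 5F
 (leaf 4F 2F 0F 5F true)
 (branch 4F 5F
 (branch 3F 4F
 (leaf 3F 4F 2F 5F true)
 (branch 0F 3F
 (branch 4F 6F
 (leaf 6F 4F 2F 5F true)
 (branch 0F 6F
 (branch 2F 6F
 (leaf 4F 2F 0F 6F true)
 (branch 3F 6F
 (leaf 1F 3F 0F 6F true)
 (leaf 4F 3F 2F 6F false)))
 (leaf 3F 4F 0F 6F false)))
 (leaf 2F 3F 0F 4F false)))
 (branch 3F 4F
 (branch 1F 4F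
 (leaf 2F 4F 1F 3F true)
 (leaf 1F 4F 0F 5F false))
 (leaf 3F 4F 0F 5F false))))
 (branch 1F 5F
 (branch 3F 5F
 (branch 4F 5F
 (leaf 4F 5F 1F 3F true)
 (branch 0F 5F
 (branch 0F 3F
 (leaf 1F 3F 0F 5F true)
 (branch 3F 4F
 (leaf 4F 3F 1F 5F true)
 (leaf 2F 3F 0F 4F false)))
 (leaf 2F 5F 0F 4F false)))
 (branch 4F 5F
 (branch 1F 4F
 (leaf 2F 4F 1F 5F true)
 (branch 0F 1F
 (branch 0F 5F
 (leaf 3F 1F 0F 5F true)
 (branch 0F 3F
 (leaf 5F 1F 0F 3F true)
 (leaf 2F 3F 0F 5F false)))
 (leaf 2F 1F 0F 4F false)))
 (leaf 4F 5F 2F 3F false)))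
 (leaf 3F 2F 1F 5F false))))
 (branch 1F 4F
 (branch 3F 4F
 (branch 4F 5F
 (leaf 5F 4F 1F 3F true)
 (branch 3F 5F
 (leaf 5F 3F 1F 4F true)
 (branch 2F 5F
 (branch 3F 6F
 (leaf 6F 3F 1F 4F true)
 (branch 2F 6F
 (branch 0F 5F
 (leaf 6F 2F 0F 5F true)
 (branch 0F 3F
 (branch 0F 4F
 (leaf 1F 3F 0F 4F true)
 (leaf 2F 4F 0F 5F false))
 (leaf 2F 3F 0F 5F false)))
 (leaf 5F 3F 2F 6F false)))
 (leaf 3F 5F 2F 4F false))))
 (branch 4F 5F
 (branch 3F 5F
 (branch 1F 5F
 (leaf 3F 5F 1F 4F true)
 (branch 2F 5F
 (branch 0F 5F
 (leaf 3F 5F 0F 2F true)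
 (branch 0F 1F
 (branch 0F 3F
 (leaf 4F 1F 0F 3F true)
 (branch 0F 4F
 (leaf 3F 1F 0F 4F true)
 (leaf 2F 3F 0F 4F false)))
 (leaf 2F 1F 0F 5F false)))
 (leaf 3F 2F 1F 5F false)))
 (leaf 5F 3F 2F 4F false))
 (leaf 5F 4F 2F 3F false)))
 (leaf 3F 2F 1F 4F false)))
 (branch 2F 4F
 (branch 2F 5F
 (branch 2F 6F
 (branch 0F 4F
 (leaf 5F 2F 0F 4F true)
 (branch 0F 5F
 (leaf 4F 2F 0F 5F true)
 (branch 0F 6F
 (leaf 4F 2F 0F 6F true)
 (branch 3F 4F
 (branch 4F 5F
 (leaf 3F 4F 2F 5F true)
 (branch 4F 6F
 (leaf 3F 4F 2F 6F true)
 (leaf 5F 4F 0F 6F false)))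
 (leaf 4F 3F 1F 2F false)))))
 (leaf 6F 2F 1F 3F false))
 (leaf 5F 2F 1F 3F false))
 (leaf 4F 2F 1F 3F false))))
 (branch 0F 1F
 (branch 2F 3F
 (branch 2F 4F
 (branch 3F 4F
 (branch 4F 5F
 (leaf 5F 4F 2F 3F true)
 (branch 3F 5F
 (leaf 5F 3F 2F 4F true)
 (branch 3F 6F
 (leaf 6F 3F 2F 4F true)
 (branch 4F 6F
 (leaf 6F 4F 2F 3F true)
 (branch 5F 6F
 (branch 0F 5F
 (branch 1F 5F
 (leaf 6F 5F 0F 1F true)
 (branch 1F 3F
 (branch 1F 4F
 (leaf 2F 3F 1F 4F true)
 (leaf 3F 5F 1F 4F false))
 (leaf 4F 5F 1F 3F false)))
 (branch 2F 5F
 (branch 0F 3F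
 (branch 0F 4F
 (leaf 2F 3F 0F 4F true)
 (leaf 3F 5F 0F 4F false))
 (leaf 4F 5F 0F 3F false))
 (leaf 1F 2F 0F 5F false)))
 (leaf 4F 5F 3F 6F false))))))
 (branch 0F 5F
 (branch 1F 5F
 (branch 4F 5F
 (leaf 4F 5F 0F 1F true)
 (branch 3F 5F
 (leaf 3F 5F 0F 1F true)
 (branch 5F 6F
 (leaf 6F 5F 0F 1F true)
 (leaf 6F 5F 3F 4F false))))
 (branch 4F 5F
 (branch 0F 4F
 (leaf 2F 4F 0F 5F true)
 (branch 0F 3F
 (branch 3F 5F
 (leaf 2F 3F 0F 5F true)
 (branch 1F 3F
 (leaf 2F 3F 0F 1F true)
 (leaf 4F 3F 1F 5F false)))
 (branch 4F 6F
 (branch 2F 5F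
 (leaf 6F 4F 2F 5F true)
 (branch 2F 6F
 (leaf 5F 4F 2F 6F true)
 (leaf 6F 2F 1F 5F false)))
 (leaf 6F 4F 0F 3F false))))
 (branch 1F 4F
 (branch 0F 4F
 (leaf 2F 4F 0F 1F true)
 (branch 0F 3F
 (branch 1F 3F
 (leaf 2F 3F 0F 1F true)
 (branch 3F 5F
 (leaf 2F 3F 0F 5F true)
 (leaf 4F 3F 1F 5F false)))
 (leaf 5F 4F 0F 3F false)))
 (leaf 3F 4F 1F 5F false))))
 (branch 2F 5F
 (branch 4F 5F
 (branch 3F 5F
 (leaf 3F 5F 2F 4F true)
 (branch 0F 3F
 (branch 1F 3F
 (leaf 2F 3F 0F 1F true)
 (branch 1F 4F
 (branch 1F 5F
 (leaf 2F 4F 1F 5F true)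
 (leaf 4F 3F 1F 5F false))
 (leaf 5F 3F 1F 4F false)))
 (leaf 4F 3F 0F 5F false)))
 (branch 0F 4F
 (branch 1F 4F
 (leaf 2F 4F 0F 1F true)
 (branch 1F 3F
 (branch 1F 5F
 (branch 3F 5F
 (leaf 2F 3F 1F 5F true)
 (branch 0F 3F
 (leaf 2F 3F 0F 1F true)
 (leaf 4F 3F 0F 5F false)))
 (leaf 3F 4F 1F 5F false))
 (leaf 5F 4F 1F 3F false)))
 (leaf 3F 4F 0F 5F false)))
 (leaf 1F 2F 0F 5F false))))
 (branch 0F 4F
 (branch 1F 4F
 (branch 3F 4F
 (leaf 3F 4F 0F 1F true)
 (branch 4F 5F
 (leaf 5F 4F 0F 1F true)
 (branch 2F 5F
 (branch 4F 6F
 (leaf 6F 4F 0F 1F true)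
 (branch 2F 6F
 (branch 3F 5F
 (branch 3F 6F
 (leaf 5F 3F 2F 6F true)
 (leaf 5F 4F 3F 6F false))
 (leaf 6F 4F 3F 5F false))
 (leaf 3F 4F 2F 6F false)))
 (leaf 3F 4F 2F 5F false))))
 (branch 2F 5F
 (branch 2F 6F
 (branch 3F 4F
 (branch 0F 3F
 (leaf 2F 3F 0F 4F true)
 (branch 3F 5F
 (leaf 4F 3F 2F 5F true)
 (branch 4F 5F
 (branch 0F 5F
 (leaf 2F 5F 0F 4F true)
 (branch 3F 6F
 (leaf 4F 3F 2F 6F true)
 (leaf 6F 3F 0F 5F false)))
 (leaf 5F 4F 1F 2F false))))
 (leaf 3F 4F 1F 2F false))
 (leaf 6F 2F 1F 4F false))
 (leaf 5F 2F 1F 4F false)))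
 (leaf 1F 2F 0F 4F false)))
 (branch 0F 3F
 (branch 1F 3F
 (branch 1F 4F
 (leaf 4F 1F 0F 3F true)
 (branch 2F 4F
 (branch 1F 5F
 (leaf 5F 1F 0F 3F true)
 (branch 2F 5F
 (branch 3F 4F
 (leaf 4F 3F 0F 1F true)
 (branch 4F 5F
 (branch 3F 5F
 (leaf 3F 5F 2F 4F true)
 (branch 1F 6F
 (leaf 6F 1F 0F 3F true)
 (branch 4F 6F
 (leaf 6F 4F 2F 5F true)
 (leaf 3F 4F 1F 6F false))))
 (leaf 3F 4F 1F 5F false)))
 (leaf 3F 2F 1F 5F false)))
 (leaf 3F 2F 1F 4F false)))
 (branch 2F 4F
 (branch 2F 5F
 (branch 2F 6F
 (branch 3F 4F
 (branch 0F 4F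
 (leaf 2F 4F 0F 3F true)
 (branch 4F 5F
 (leaf 3F 4F 2F 5F true)
 (branch 3F 5F
 (branch 0F 5F
 (leaf 2F 5F 0F 3F true)
 (branch 4F 6F
 (leaf 3F 4F 2F 6F true)
 (leaf 6F 4F 0F 5F false)))
 (leaf 5F 3F 1F 2F false))))
 (leaf 4F 3F 1F 2F false))
 (leaf 6F 2F 1F 3F false))
 (leaf 5F 2F 1F 3F false))
 (leaf 4F 2F 1F 3F false)))
 (leaf 1F 2F 0F 3F false)))
 (branch 2F 3F
 (branch 2F 4F
 (branch 2F 5F
 (branch 2F 6F
 (branch 1F 3F
 (branch 1F 4F
 (branch 3F 4F
 (leaf 2F 3F 1F 4F true)
 (branch 1F 5F
 (branch 4F 5F
 (leaf 2F 4F 1F 5F true)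
 (branch 3F 5F
 (leaf 2F 3F 1F 5F true)
 (branch 4F 6F
 (branch 1F 6F
 (leaf 2F 4F 1F 6F true)
 (leaf 6F 1F 0F 2F false))
 (leaf 6F 4F 3F 5F false))))
 (leaf 5F 1F 0F 2F false)))
 (leaf 4F 1F 0F 2F false))
 (leaf 3F 1F 0F 2F false))
 (leaf 6F 2F 0F 1F false))
 (leaf 5F 2F 0F 1F false))
 (leaf 4F 2F 0F 1F false))
 (leaf 3F 2F 0F 1F false)))))

certificate₂ : Certificate 7 4
certificate₂ =
 (branch 0F 2F
 (branch 1F 2F
 (branch 0F 1F
 (branch 0F 3F
 (leaf 3F 0F 1F 2F true)
 (branch 0F 4F
 (leaf 4F 0F 1F 2F true)
 (branch 0F 5F
 (leaf 5F 0F 1F 2F true)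
 (branch 0F 6F
 (leaf 6F 0F 1F 2F true)
 (branch 3F 4F
 (branch 3F 5F
 (branch 3F 6F
 (branch 4F 5F
 (leaf 6F 3F 4F 5F true)
 (leaf 6F 0F 4F 5F false))
 (leaf 4F 0F 3F 6F false))
 (leaf 4F 0F 3F 5F false))
 (leaf 5F 0F 3F 4F false))))))
 (branch 1F 3F
 (branch 2F 3F
 (leaf 0F 2F 1F 3F true)
 (branch 1F 4F
 (branch 2F 4F
 (leaf 0F 2F 1F 4F true)
 (branch 3F 4F
 (branch 1F 5F
 (leaf 5F 1F 3F 4F true)
 (branch 1F 6F
 (leaf 6F 1F 3F 4F true)
 (branch 4F 5F
 (leaf 5F 4F 3F 1F true)
 (branch 0F 5F
 (branch 2F 5F
 (branch 0F 3F
 (leaf 0F 3F 1F 4F true)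
 (branch 0F 6F
 (leaf 6F 0F 2F 5F true)
 (leaf 3F 0F 1F 6F false)))
 (leaf 1F 5F 2F 4F false))
 (leaf 4F 5F 1F 0F false)))))
 (branch 2F 5F
 (branch 1F 5F
 (leaf 0F 2F 1F 5F true)
 (branch 2F 6F
 (branch 1F 6F
 (leaf 0F 2F 1F 6F true)
 (branch 0F 5F
 (branch 0F 6F
 (leaf 5F 0F 2F 6F true)
 (branch 5F 6F
 (leaf 0F 5F 2F 6F true)
 (leaf 0F 6F 1F 5F false)))
 (branch 0F 6F
 (branch 5F 6F
 (leaf 0F 6F 2F 5F true)
 (leaf 0F 5F 1F 6F false))
 (leaf 5F 0F 1F 6F false))))
 (leaf 6F 2F 3F 4F false)))
 (leaf 5F 2F 3F 4F false))))
 (branch 0F 4F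
 (branch 2F 4F
 (branch 0F 5F
 (leaf 5F 0F 2F 4F true)
 (branch 0F 6F
 (leaf 6F 0F 2F 4F true)
 (branch 1F 5F
 (branch 2F 5F
 (leaf 0F 2F 1F 5F true)
 (branch 1F 6F
 (branch 2F 6F
 (leaf 0F 2F 1F 6F true)
 (branch 3F 5F
 (leaf 6F 1F 3F 5F true)
 (leaf 0F 5F 2F 3F false)))
 (leaf 5F 0F 1F 6F false)))
 (leaf 6F 0F 1F 5F false))))
 (branch 3F 4F
 (branch 2F 5F
 (branch 1F 5F
 (leaf 0F 2F 1F 5F true)
 (branch 0F 5F
 (leaf 4F 0F 2F 5F true)
 (branch 4F 5F
 (branch 3F 5F
 (leaf 0F 4F 3F 5F true)
 (leaf 3F 5F 1F 0F false))
 (leaf 0F 5F 1F 4F false))))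
 (branch 3F 5F
 (branch 4F 5F
 (leaf 0F 4F 3F 5F true)
 (leaf 1F 4F 2F 5F false))
 (leaf 4F 2F 3F 5F false)))
 (leaf 1F 4F 2F 3F false)))
 (branch 0F 5F
 (branch 0F 6F
 (branch 2F 5F
 (leaf 6F 0F 2F 5F true)
 (branch 2F 6F
 (leaf 5F 0F 2F 6F true)
 (branch 2F 4F
 (branch 3F 5F
 (branch 0F 3F
 (leaf 6F 0F 3F 5F true)
 (leaf 3F 0F 1F 4F false))
 (leaf 6F 2F 3F 5F false))
 (leaf 2F 4F 1F 0F false))))
 (leaf 6F 0F 1F 4F false))
 (leaf 5F 0F 1F 4F false)))))
 (branch 0F 3F
 (branch 2F 3F
 (branch 0F 4F
 (leaf 4F 0F 2F 3F true)
 (branch 0F 5F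
 (leaf 5F 0F 2F 3F true)
 (branch 1F 4F
 (branch 1F 5F
 (branch 2F 4F
 (leaf 0F 2F 1F 4F true)
 (branch 2F 5F
 (leaf 0F 2F 1F 5F true)
 (branch 4F 5F
 (branch 1F 6F
 (leaf 6F 1F 4F 5F true)
 (branch 0F 6F
 (leaf 6F 0F 2F 3F true)
 (leaf 4F 0F 1F 6F false)))
 (leaf 0F 4F 2F 5F false))))
 (leaf 4F 0F 1F 5F false))
 (leaf 5F 0F 1F 4F false))))
 (branch 2F 4F
 (branch 0F 4F
 (leaf 3F 0F 2F 4F true)
 (branch 1F 4F
 (leaf 0F 2F 1F 4F true)
 (branch 3F 4F
 (branch 0F 5F
 (branch 2F 5F
 (leaf 3F 0F 2F 5F true)
 (branch 3F 5F
 (branch 4F 5F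
 (leaf 0F 5F 3F 4F true)
 (leaf 5F 4F 1F 0F false))
 (leaf 1F 3F 2F 5F false)))
 (leaf 5F 0F 1F 4F false))
 (leaf 0F 4F 1F 3F false))))
 (branch 3F 4F
 (branch 2F 5F
 (branch 0F 5F
 (leaf 3F 0F 2F 5F true)
 (branch 1F 5F
 (leaf 0F 2F 1F 5F true)
 (branch 3F 5F
 (branch 4F 5F
 (leaf 2F 5F 3F 4F true)
 (leaf 4F 5F 1F 0F false))
 (leaf 0F 5F 1F 3F false))))
 (branch 3F 5F
 (branch 4F 5F
 (branch 0F 5F
 (leaf 0F 5F 3F 4F true)
 (branch 0F 4F
 (leaf 0F 4F 3F 5F true)
 (branch 1F 5F
 (leaf 1F 5F 3F 4F true)
 (leaf 2F 5F 1F 0F false))))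
 (branch 2F 6F
 (branch 0F 6F
 (leaf 3F 0F 2F 6F true)
 (branch 1F 6F
 (leaf 0F 2F 1F 6F true)
 (branch 5F 6F
 (branch 3F 6F
 (leaf 2F 6F 3F 5F true)
 (leaf 0F 6F 1F 3F false))
 (leaf 5F 6F 1F 0F false))))
 (leaf 6F 2F 4F 5F false)))
 (leaf 1F 3F 2F 5F false)))
 (leaf 1F 3F 2F 4F false))))
 (branch 0F 4F
 (branch 0F 5F
 (branch 0F 6F
 (branch 2F 4F
 (leaf 5F 0F 2F 4F true)
 (branch 2F 5F
 (leaf 4F 0F 2F 5F true)
 (branch 2F 6F
 (leaf 4F 0F 2F 6F true)
 (branch 4F 5F
 (leaf 6F 0F 4F 5F true)
 (leaf 6F 2F 4F 5F false)))))
 (leaf 6F 0F 1F 3F false))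
 (leaf 5F 0F 1F 3F false))
 (leaf 4F 0F 1F 3F false)))))
 (branch 2F 3F
 (branch 0F 3F
 (branch 0F 4F
 (leaf 4F 0F 2F 3F true)
 (branch 0F 5F
 (leaf 5F 0F 2F 3F true)
 (branch 0F 6F
 (leaf 6F 0F 2F 3F true)
 (branch 3F 4F
 (leaf 4F 3F 2F 0F true)
 (branch 3F 5F
 (leaf 5F 3F 2F 0F true)
 (branch 4F 5F
 (branch 3F 6F
 (leaf 6F 3F 2F 0F true)
 (branch 4F 6F
 (branch 5F 6F
 (branch 1F 5F
 (leaf 1F 5F 4F 6F true)
 (branch 0F 1F
 (branch 1F 3F
 (leaf 2F 0F 1F 3F true)
 (leaf 0F 5F 1F 3F false))
 (leaf 3F 5F 1F 0F false)))
 (leaf 0F 5F 3F 6F false))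
 (leaf 0F 4F 3F 6F false)))
 (leaf 0F 4F 3F 5F false)))))))
 (branch 2F 4F
 (branch 3F 4F
 (branch 0F 4F
 (leaf 0F 4F 2F 3F true)
 (branch 2F 5F
 (leaf 5F 2F 3F 4F true)
 (branch 2F 6F
 (leaf 6F 2F 3F 4F true)
 (branch 1F 4F
 (leaf 1F 4F 2F 3F true)
 (branch 1F 5F
 (branch 1F 6F
 (branch 0F 1F
 (branch 0F 5F
 (leaf 2F 0F 1F 5F true)
 (branch 0F 6F
 (leaf 2F 0F 1F 6F true)
 (branch 3F 5F
 (branch 4F 5F
 (leaf 1F 5F 3F 4F true)
 (leaf 6F 0F 4F 5F false))
 (leaf 4F 0F 3F 5F false))))
 (leaf 3F 0F 1F 4F false))
 (leaf 4F 1F 2F 6F false))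
 (leaf 4F 1F 2F 5F false))))))
 (branch 0F 4F
 (branch 0F 5F
 (leaf 5F 0F 2F 4F true)
 (branch 4F 5F
 (leaf 5F 4F 2F 0F true)
 (branch 3F 5F
 (branch 2F 5F
 (leaf 4F 2F 3F 5F true)
 (branch 1F 5F
 (branch 4F 6F
 (leaf 6F 4F 2F 0F true)
 (branch 5F 6F
 (branch 3F 6F
 (leaf 1F 5F 3F 6F true)
 (branch 0F 6F
 (leaf 6F 0F 2F 4F true)
 (leaf 0F 6F 3F 4F false)))
 (leaf 0F 5F 4F 6F false)))
 (leaf 0F 5F 1F 2F false)))
 (leaf 0F 5F 3F 4F false))))
 (branch 0F 5F
 (branch 4F 5F
 (branch 2F 5F
 (leaf 0F 5F 2F 4F true)
 (branch 4F 6F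
 (branch 5F 6F
 (leaf 0F 5F 4F 6F true)
 (branch 1F 5F
 (branch 0F 1F
 (leaf 2F 0F 1F 5F true)
 (branch 1F 4F
 (leaf 0F 5F 1F 4F true)
 (leaf 3F 0F 1F 4F false)))
 (leaf 6F 5F 2F 1F false)))
 (leaf 6F 4F 3F 0F false)))
 (leaf 5F 4F 3F 0F false))
 (leaf 5F 0F 3F 4F false))))
 (branch 1F 4F
 (branch 0F 4F
 (branch 0F 1F
 (leaf 2F 0F 1F 4F true)
 (branch 1F 3F
 (branch 3F 4F
 (leaf 0F 4F 1F 3F true)
 (branch 1F 5F
 (branch 3F 5F
 (leaf 4F 1F 3F 5F true)
 (branch 4F 5F
 (leaf 0F 4F 1F 5F true)
 (leaf 2F 4F 3F 5F false)))
 (branch 0F 5F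
 (branch 2F 5F
 (leaf 4F 0F 2F 5F true)
 (branch 4F 5F
 (branch 5F 6F
 (leaf 6F 5F 4F 0F true)
 (leaf 6F 5F 2F 1F false))
 (leaf 1F 5F 2F 4F false)))
 (leaf 3F 0F 1F 5F false))))
 (branch 0F 5F
 (branch 0F 6F
 (branch 2F 5F
 (leaf 4F 0F 2F 5F true)
 (branch 2F 6F
 (leaf 4F 0F 2F 6F true)
 (branch 4F 5F
 (leaf 6F 0F 4F 5F true)
 (leaf 6F 2F 4F 5F false))))
 (leaf 6F 0F 1F 3F false))
 (leaf 5F 0F 1F 3F false))))
 (branch 3F 4F
 (branch 1F 3F
 (branch 4F 5F
 (leaf 5F 4F 3F 1F true)
 (branch 2F 5F
 (branch 3F 5F
 (leaf 1F 3F 2F 5F true)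
 (branch 0F 5F
 (branch 4F 6F
 (leaf 6F 4F 3F 1F true)
 (branch 5F 6F
 (leaf 6F 5F 2F 0F true)
 (leaf 3F 5F 4F 6F false)))
 (leaf 4F 0F 3F 5F false)))
 (leaf 0F 4F 2F 5F false)))
 (branch 0F 1F
 (branch 1F 5F
 (branch 0F 5F
 (leaf 2F 0F 1F 5F true)
 (branch 3F 5F
 (branch 4F 5F
 (leaf 1F 4F 3F 5F true)
 (branch 2F 5F
 (leaf 1F 5F 2F 3F true)
 (leaf 0F 4F 2F 5F false)))
 (leaf 4F 0F 3F 5F false)))
 (branch 2F 5F
 (branch 3F 5F
 (branch 4F 5F
 (leaf 1F 4F 3F 5F true)
 (branch 0F 5F
 (leaf 0F 5F 2F 3F true)
 (branch 5F 6F
 (leaf 6F 5F 3F 2F true)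
 (leaf 6F 5F 4F 0F false))))
 (leaf 0F 3F 1F 5F false))
 (leaf 3F 1F 2F 5F false)))
 (leaf 4F 0F 1F 3F false)))
 (branch 4F 5F
 (branch 4F 6F
 (branch 0F 5F
 (branch 5F 6F
 (leaf 0F 5F 4F 6F true)
 (branch 0F 6F
 (branch 2F 5F
 (leaf 4F 5F 2F 0F true)
 (branch 1F 5F
 (leaf 0F 5F 1F 4F true)
 (leaf 6F 5F 2F 1F false)))
 (leaf 6F 0F 3F 4F false)))
 (leaf 5F 0F 3F 4F false))
 (leaf 6F 4F 3F 0F false))
 (leaf 5F 4F 3F 0F false))))
 (branch 0F 4F
 (branch 1F 5F
 (branch 1F 6F
 (branch 1F 3F
 (branch 3F 5F
 (leaf 6F 1F 3F 5F true)
 (branch 3F 6F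
 (leaf 5F 1F 3F 6F true)
 (branch 4F 5F
 (branch 4F 6F
 (branch 5F 6F
 (leaf 1F 5F 4F 6F true)
 (branch 0F 5F
 (branch 0F 6F
 (leaf 5F 0F 4F 6F true)
 (leaf 0F 6F 3F 5F false))
 (leaf 0F 5F 3F 6F false)))
 (leaf 6F 4F 2F 1F false))
 (leaf 5F 4F 2F 1F false))))
 (leaf 3F 1F 2F 4F false))
 (leaf 6F 1F 2F 4F false))
 (leaf 5F 1F 2F 4F false))
 (leaf 0F 4F 1F 2F false)))))
 (branch 1F 3F
 (branch 0F 3F
 (branch 0F 1F
 (leaf 2F 0F 1F 3F true)
 (branch 0F 4F
 (branch 2F 4F
 (leaf 3F 0F 2F 4F true)
 (branch 3F 4F
 (branch 1F 4F
 (leaf 0F 3F 1F 4F true)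
 (branch 4F 5F
 (leaf 5F 4F 3F 0F true)
 (leaf 5F 4F 2F 1F false)))
 (branch 1F 4F
 (branch 2F 5F
 (branch 0F 5F
 (leaf 3F 0F 2F 5F true)
 (branch 2F 6F
 (branch 0F 6F
 (leaf 3F 0F 2F 6F true)
 (branch 1F 5F
 (branch 3F 5F
 (leaf 0F 3F 1F 5F true)
 (branch 4F 5F
 (leaf 0F 4F 1F 5F true)
 (leaf 0F 5F 3F 4F false)))
 (leaf 6F 0F 1F 5F false)))
 (leaf 6F 2F 3F 4F false)))
 (leaf 5F 2F 3F 4F false))
 (leaf 1F 4F 2F 3F false))))
 (branch 1F 4F
 (branch 3F 4F
 (leaf 0F 3F 1F 4F true)
 (branch 2F 4F
 (branch 1F 5F
 (branch 3F 5F
 (leaf 0F 3F 1F 5F true)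
 (branch 4F 5F
 (branch 2F 5F
 (leaf 1F 4F 2F 5F true)
 (branch 5F 6F
 (leaf 6F 5F 4F 1F true)
 (leaf 6F 5F 3F 2F false)))
 (leaf 0F 4F 3F 5F false)))
 (branch 0F 5F
 (branch 2F 5F
 (leaf 3F 0F 2F 5F true)
 (branch 3F 5F
 (branch 5F 6F
 (leaf 6F 5F 3F 0F true)
 (leaf 6F 5F 2F 1F false))
 (leaf 1F 5F 2F 3F false)))
 (leaf 4F 0F 1F 5F false)))
 (leaf 0F 4F 2F 3F false)))
 (branch 2F 4F
 (branch 0F 5F
 (branch 0F 6F
 (branch 2F 5F
 (leaf 3F 0F 2F 5F true)
 (branch 2F 6F
 (leaf 3F 0F 2F 6F true)
 (branch 3F 5F
 (leaf 6F 0F 3F 5F true)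
 (leaf 6F 2F 3F 5F false))))
 (leaf 6F 0F 1F 4F false))
 (leaf 5F 0F 1F 4F false))
 (leaf 0F 4F 1F 2F false)))))
 (branch 2F 4F
 (branch 0F 4F
 (branch 0F 5F
 (leaf 5F 0F 2F 4F true)
 (branch 0F 6F
 (leaf 6F 0F 2F 4F true)
 (branch 3F 5F
 (branch 3F 6F
 (branch 3F 4F
 (leaf 3F 4F 2F 0F true)
 (branch 4F 5F
 (leaf 5F 4F 2F 0F true)
 (branch 4F 6F
 (leaf 6F 4F 2F 0F true)
 (branch 5F 6F
 (branch 1F 5F
 (leaf 1F 5F 3F 6F true)
 (branch 0F 1F
 (branch 1F 4F
 (leaf 2F 0F 1F 4F true)
 (leaf 0F 5F 1F 4F false))
 (leaf 3F 0F 1F 5F false)))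
 (leaf 0F 5F 4F 6F false)))))
 (leaf 5F 0F 3F 6F false))
 (leaf 6F 0F 3F 5F false))))
 (branch 3F 4F
 (branch 1F 4F
 (branch 4F 5F
 (leaf 5F 4F 3F 1F true)
 (branch 4F 6F
 (leaf 6F 4F 3F 1F true)
 (branch 1F 5F
 (leaf 5F 1F 3F 4F true)
 (branch 5F 6F
 (branch 2F 5F
 (branch 0F 5F
 (leaf 6F 5F 2F 0F true)
 (branch 0F 1F
 (branch 0F 6F
 (branch 1F 6F
 (leaf 2F 0F 1F 6F true)
 (branch 2F 6F
 (leaf 0F 6F 2F 5F true)
 (leaf 4F 6F 2F 1F false)))
 (leaf 5F 0F 4F 6F false))
 (leaf 3F 0F 1F 5F false)))
 (leaf 4F 5F 2F 1F false))
 (leaf 1F 5F 4F 6F false)))))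
 (branch 0F 1F
 (branch 1F 5F
 (branch 0F 5F
 (leaf 2F 0F 1F 5F true)
 (branch 3F 5F
 (branch 4F 5F
 (leaf 1F 5F 3F 4F true)
 (branch 5F 6F
 (leaf 6F 5F 3F 1F true)
 (leaf 6F 5F 4F 0F false)))
 (leaf 4F 0F 3F 5F false)))
 (branch 2F 5F
 (branch 4F 5F
 (branch 0F 5F
 (leaf 0F 5F 2F 4F true)
 (branch 3F 5F
 (leaf 2F 4F 3F 5F true)
 (leaf 4F 0F 3F 5F false)))
 (leaf 0F 4F 1F 5F false))
 (leaf 4F 1F 2F 5F false)))
 (leaf 3F 0F 1F 4F false)))
 (branch 0F 5F
 (branch 4F 5F
 (branch 2F 5F
 (leaf 0F 5F 2F 4F true)
 (branch 3F 5F
 (branch 1F 5F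
 (leaf 0F 5F 1F 3F true)
 (branch 5F 6F
 (branch 4F 6F
 (leaf 0F 5F 4F 6F true)
 (leaf 6F 4F 3F 0F false))
 (leaf 6F 5F 2F 1F false)))
 (leaf 0F 3F 2F 5F false)))
 (leaf 5F 4F 3F 0F false))
 (leaf 5F 0F 3F 4F false))))
 (branch 3F 4F
 (branch 1F 4F
 (branch 4F 5F
 (leaf 5F 4F 3F 1F true)
 (branch 1F 5F
 (leaf 5F 1F 3F 4F true)
 (branch 2F 5F
 (branch 4F 6F
 (leaf 6F 4F 3F 1F true)
 (branch 5F 6F
 (branch 0F 5F
 (leaf 6F 5F 2F 0F true)
 (branch 0F 1F
 (branch 0F 4F
 (leaf 0F 4F 1F 3F true)
 (branch 0F 6F
 (branch 2F 6F
 (leaf 0F 6F 2F 5F true)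
 (leaf 0F 4F 2F 6F false))
 (leaf 5F 0F 4F 6F false)))
 (leaf 3F 0F 1F 5F false)))
 (leaf 1F 5F 4F 6F false)))
 (leaf 1F 5F 2F 4F false))))
 (branch 4F 5F
 (branch 1F 5F
 (branch 3F 5F
 (leaf 1F 5F 3F 4F true)
 (branch 2F 5F
 (branch 0F 5F
 (leaf 4F 5F 2F 0F true)
 (branch 0F 4F
 (branch 5F 6F
 (branch 4F 6F
 (leaf 1F 5F 4F 6F true)
 (leaf 6F 4F 2F 1F false))
 (leaf 6F 5F 3F 0F false))
 (leaf 0F 4F 1F 2F false)))
 (leaf 0F 3F 2F 5F false)))
 (leaf 5F 1F 2F 4F false))
 (leaf 5F 4F 2F 1F false)))
 (leaf 0F 3F 2F 4F false))))
 (branch 1F 4F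
 (branch 1F 5F
 (branch 1F 6F
 (branch 4F 5F
 (leaf 6F 1F 4F 5F true)
 (branch 4F 6F
 (leaf 5F 1F 4F 6F true)
 (branch 3F 4F
 (branch 3F 5F
 (branch 3F 6F
 (branch 5F 6F
 (leaf 1F 5F 3F 6F true)
 (branch 0F 5F
 (branch 0F 1F
 (leaf 2F 0F 1F 5F true)
 (branch 0F 3F
 (branch 0F 6F
 (leaf 5F 0F 3F 6F true)
 (leaf 0F 6F 4F 5F false))
 (leaf 0F 3F 1F 2F false)))
 (leaf 0F 5F 4F 6F false)))
 (leaf 6F 3F 2F 1F false))
 (leaf 5F 3F 2F 1F false))
 (leaf 4F 3F 2F 1F false))))
 (leaf 6F 1F 2F 3F false))
 (leaf 5F 1F 2F 3F false))
 (leaf 4F 1F 2F 3F false)))))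
 (branch 1F 2F
 (branch 2F 3F
 (branch 1F 3F
 (branch 1F 4F
 (leaf 4F 1F 2F 3F true)
 (branch 1F 5F
 (leaf 5F 1F 2F 3F true)
 (branch 1F 6F
 (leaf 6F 1F 2F 3F true)
 (branch 4F 5F
 (branch 4F 6F
 (branch 3F 4F
 (leaf 4F 3F 2F 1F true)
 (branch 3F 5F
 (leaf 5F 3F 2F 1F true)
 (branch 3F 6F
 (leaf 6F 3F 2F 1F true)
 (branch 5F 6F
 (branch 0F 5F
 (leaf 0F 5F 4F 6F true)
 (branch 0F 1F
 (branch 0F 3F
 (leaf 0F 3F 1F 2F true)
 (branch 0F 6F
 (leaf 0F 6F 4F 5F true)
 (leaf 5F 0F 3F 6F false)))
 (leaf 2F 0F 1F 5F false)))
 (leaf 1F 5F 3F 6F false)))))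
 (leaf 5F 1F 4F 6F false))
 (leaf 6F 1F 4F 5F false)))))
 (branch 0F 3F
 (branch 2F 4F
 (branch 3F 4F
 (leaf 0F 3F 2F 4F true)
 (branch 1F 4F
 (branch 4F 5F
 (leaf 5F 4F 2F 1F true)
 (branch 1F 5F
 (leaf 5F 1F 2F 4F true)
 (branch 3F 5F
 (branch 2F 5F
 (leaf 0F 3F 2F 5F true)
 (branch 0F 5F
 (branch 0F 4F
 (leaf 0F 4F 1F 2F true)
 (branch 4F 6F
 (leaf 6F 4F 2F 1F true)
 (branch 5F 6F
 (leaf 6F 5F 3F 0F true)
 (leaf 1F 5F 4F 6F false))))
 (leaf 4F 5F 2F 0F false)))
 (leaf 1F 5F 3F 4F false))))
 (branch 4F 5F
 (branch 1F 5F
 (branch 2F 5F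
 (leaf 1F 5F 2F 4F true)
 (branch 4F 6F
 (branch 5F 6F
 (leaf 1F 5F 4F 6F true)
 (branch 0F 5F
 (branch 0F 1F
 (leaf 3F 0F 1F 5F true)
 (branch 0F 4F
 (branch 0F 6F
 (leaf 5F 0F 4F 6F true)
 (branch 1F 6F
 (branch 2F 6F
 (leaf 0F 4F 2F 6F true)
 (leaf 0F 6F 2F 5F false))
 (leaf 2F 0F 1F 6F false)))
 (leaf 0F 4F 1F 3F false)))
 (leaf 6F 5F 2F 0F false)))
 (leaf 6F 4F 3F 1F false)))
 (leaf 5F 1F 3F 4F false))
 (leaf 5F 4F 3F 1F false))))
 (branch 0F 4F
 (branch 3F 4F
 (branch 0F 5F
 (leaf 5F 0F 3F 4F true)
 (branch 4F 5F
 (leaf 5F 4F 3F 0F true)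
 (branch 2F 5F
 (branch 3F 5F
 (leaf 0F 3F 2F 5F true)
 (branch 1F 5F
 (branch 5F 6F
 (leaf 6F 5F 2F 1F true)
 (branch 4F 6F
 (leaf 6F 4F 3F 0F true)
 (leaf 0F 5F 4F 6F false)))
 (leaf 0F 5F 1F 3F false)))
 (leaf 0F 5F 2F 4F false))))
 (branch 1F 4F
 (branch 0F 1F
 (leaf 3F 0F 1F 4F true)
 (branch 1F 5F
 (branch 2F 5F
 (leaf 4F 1F 2F 5F true)
 (branch 4F 5F
 (leaf 0F 4F 1F 5F true)
 (branch 0F 5F
 (branch 3F 5F
 (leaf 4F 0F 3F 5F true)
 (leaf 2F 4F 3F 5F false))
 (leaf 0F 5F 2F 4F false))))
 (branch 0F 5F
 (branch 3F 5F
 (leaf 4F 0F 3F 5F true)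
 (branch 4F 5F
 (branch 5F 6F
 (leaf 6F 5F 4F 0F true)
 (leaf 6F 5F 3F 1F false))
 (leaf 1F 5F 3F 4F false)))
 (leaf 2F 0F 1F 5F false))))
 (branch 4F 5F
 (branch 4F 6F
 (branch 1F 5F
 (branch 5F 6F
 (leaf 1F 5F 4F 6F true)
 (branch 2F 5F
 (leaf 4F 5F 2F 1F true)
 (branch 0F 5F
 (branch 0F 1F
 (leaf 3F 0F 1F 5F true)
 (branch 0F 6F
 (leaf 5F 0F 4F 6F true)
 (branch 1F 6F
 (branch 2F 6F
 (leaf 4F 6F 2F 1F true)
 (leaf 0F 6F 2F 5F false))
 (leaf 2F 0F 1F 6F false))))
 (leaf 6F 5F 2F 0F false))))
 (leaf 5F 1F 3F 4F false))
 (leaf 6F 4F 3F 1F false))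
 (leaf 5F 4F 3F 1F false))))
 (branch 0F 5F
 (branch 0F 6F
 (branch 3F 5F
 (leaf 6F 0F 3F 5F true)
 (branch 3F 6F
 (leaf 5F 0F 3F 6F true)
 (branch 3F 4F
 (branch 4F 5F
 (branch 4F 6F
 (branch 5F 6F
 (leaf 0F 5F 4F 6F true)
 (branch 1F 5F
 (branch 0F 1F
 (leaf 3F 0F 1F 5F true)
 (branch 1F 4F
 (leaf 0F 5F 1F 4F true)
 (leaf 2F 0F 1F 4F false)))
 (leaf 1F 5F 3F 6F false)))
 (leaf 6F 4F 2F 0F false))
 (leaf 5F 4F 2F 0F false))
 (leaf 3F 4F 2F 0F false))))
 (leaf 6F 0F 2F 4F false))
 (leaf 5F 0F 2F 4F false))))
 (branch 0F 1F
 (branch 0F 4F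
 (branch 1F 4F
 (branch 2F 4F
 (leaf 0F 4F 1F 2F true)
 (branch 0F 5F
 (leaf 5F 0F 1F 4F true)
 (branch 0F 6F
 (leaf 6F 0F 1F 4F true)
 (branch 2F 5F
 (branch 2F 6F
 (branch 3F 5F
 (leaf 6F 2F 3F 5F true)
 (leaf 6F 0F 3F 5F false))
 (leaf 3F 0F 2F 6F false))
 (leaf 3F 0F 2F 5F false)))))
 (branch 3F 4F
 (branch 2F 4F
 (leaf 0F 4F 2F 3F true)
 (branch 1F 5F
 (branch 0F 5F
 (leaf 4F 0F 1F 5F true)
 (branch 2F 5F
 (branch 3F 5F
 (leaf 1F 5F 2F 3F true)
 (branch 5F 6F
 (leaf 6F 5F 2F 1F true)
 (leaf 6F 5F 3F 0F false)))
 (leaf 3F 0F 2F 5F false)))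
 (branch 3F 5F
 (branch 4F 5F
 (leaf 0F 4F 3F 5F true)
 (branch 2F 5F
 (branch 5F 6F
 (leaf 6F 5F 3F 2F true)
 (leaf 6F 5F 4F 1F false))
 (leaf 1F 4F 2F 5F false)))
 (leaf 0F 3F 1F 5F false))))
 (leaf 0F 3F 1F 4F false)))
 (branch 2F 4F
 (branch 3F 4F
 (branch 1F 4F
 (leaf 1F 4F 2F 3F true)
 (branch 2F 5F
 (leaf 5F 2F 3F 4F true)
 (branch 0F 5F
 (branch 2F 6F
 (leaf 6F 2F 3F 4F true)
 (branch 0F 6F
 (branch 1F 5F
 (leaf 6F 0F 1F 5F true)
 (branch 3F 5F
 (branch 4F 5F
 (leaf 0F 5F 3F 4F true)
 (leaf 0F 4F 1F 5F false))
 (leaf 0F 3F 1F 5F false)))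
 (leaf 3F 0F 2F 6F false)))
 (leaf 3F 0F 2F 5F false))))
 (branch 1F 4F
 (branch 4F 5F
 (leaf 5F 4F 2F 1F true)
 (leaf 5F 4F 3F 0F false))
 (leaf 0F 3F 1F 4F false)))
 (leaf 3F 0F 2F 4F false)))
 (leaf 2F 0F 1F 3F false))))
 (branch 0F 3F
 (branch 2F 4F
 (branch 1F 4F
 (branch 0F 4F
 (leaf 0F 4F 1F 2F true)
 (branch 1F 5F
 (leaf 5F 1F 2F 4F true)
 (branch 1F 6F
 (leaf 6F 1F 2F 4F true)
 (branch 1F 3F
 (leaf 3F 1F 2F 4F true)
 (branch 3F 5F
 (branch 3F 6F
 (branch 4F 5F
 (leaf 5F 4F 2F 1F true)
 (branch 4F 6F
 (leaf 6F 4F 2F 1F true)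
 (branch 5F 6F
 (branch 0F 5F
 (leaf 0F 5F 3F 6F true)
 (branch 0F 6F
 (leaf 0F 6F 3F 5F true)
 (leaf 5F 0F 4F 6F false)))
 (leaf 1F 5F 4F 6F false))))
 (leaf 5F 1F 3F 6F false))
 (leaf 6F 1F 3F 5F false))))))
 (branch 0F 4F
 (branch 3F 4F
 (branch 4F 5F
 (leaf 5F 4F 3F 0F true)
 (branch 4F 6F
 (leaf 6F 4F 3F 0F true)
 (branch 0F 5F
 (leaf 5F 0F 3F 4F true)
 (branch 5F 6F
 (branch 0F 6F
 (leaf 6F 0F 3F 4F true)
 (branch 2F 5F
 (branch 1F 5F
 (leaf 6F 5F 2F 1F true)
 (leaf 0F 5F 1F 4F false))
 (leaf 4F 5F 2F 0F false)))
 (leaf 0F 5F 4F 6F false)))))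
 (branch 1F 3F
 (branch 0F 1F
 (leaf 4F 0F 1F 3F true)
 (branch 1F 5F
 (branch 2F 5F
 (leaf 3F 1F 2F 5F true)
 (branch 3F 5F
 (leaf 0F 3F 1F 5F true)
 (branch 4F 5F
 (branch 0F 5F
 (branch 5F 6F
 (leaf 6F 5F 4F 0F true)
 (leaf 6F 5F 3F 2F false))
 (leaf 0F 5F 2F 3F false))
 (leaf 1F 4F 3F 5F false))))
 (branch 0F 5F
 (branch 3F 5F
 (leaf 4F 0F 3F 5F true)
 (branch 4F 5F
 (branch 2F 5F
 (leaf 0F 4F 2F 5F true)
 (leaf 1F 5F 2F 3F false))
 (leaf 1F 4F 3F 5F false)))
 (leaf 2F 0F 1F 5F false))))
 (branch 4F 5F
 (branch 2F 5F
 (leaf 0F 4F 2F 5F true)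
 (branch 3F 5F
 (branch 0F 5F
 (leaf 4F 0F 3F 5F true)
 (branch 4F 6F
 (branch 5F 6F
 (leaf 3F 5F 4F 6F true)
 (leaf 6F 5F 2F 0F false))
 (leaf 6F 4F 3F 1F false)))
 (leaf 1F 3F 2F 5F false)))
 (leaf 5F 4F 3F 1F false))))
 (branch 0F 1F
 (branch 1F 3F
 (branch 0F 5F
 (leaf 5F 0F 1F 3F true)
 (branch 0F 6F
 (leaf 6F 0F 1F 3F true)
 (branch 2F 5F
 (branch 2F 6F
 (branch 4F 5F
 (leaf 6F 2F 4F 5F true)
 (leaf 6F 0F 4F 5F false))
 (leaf 4F 0F 2F 6F false))
 (leaf 4F 0F 2F 5F false))))
 (branch 3F 4F
 (branch 1F 5F
 (branch 0F 5F
 (leaf 3F 0F 1F 5F true)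
 (branch 2F 5F
 (branch 4F 5F
 (leaf 1F 5F 2F 4F true)
 (branch 5F 6F
 (leaf 6F 5F 2F 1F true)
 (leaf 6F 5F 4F 0F false)))
 (leaf 4F 0F 2F 5F false)))
 (branch 3F 5F
 (branch 4F 5F
 (leaf 2F 4F 3F 5F true)
 (leaf 0F 4F 1F 5F false))
 (leaf 4F 1F 3F 5F false)))
 (leaf 0F 4F 1F 3F false)))
 (leaf 2F 0F 1F 4F false))))
 (branch 3F 4F
 (branch 0F 4F
 (branch 0F 5F
 (leaf 5F 0F 3F 4F true)
 (branch 4F 5F
 (leaf 5F 4F 3F 0F true)
 (branch 2F 5F
 (branch 4F 6F
 (leaf 6F 4F 3F 0F true)
 (branch 5F 6F
 (branch 1F 5F
 (leaf 6F 5F 2F 1F true)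
 (branch 0F 1F
 (branch 1F 4F
 (leaf 3F 0F 1F 4F true)
 (leaf 0F 5F 1F 4F false))
 (leaf 2F 0F 1F 5F false)))
 (leaf 0F 5F 4F 6F false)))
 (leaf 0F 5F 2F 4F false))))
 (branch 0F 5F
 (branch 4F 5F
 (branch 3F 5F
 (leaf 0F 5F 3F 4F true)
 (branch 2F 5F
 (branch 1F 5F
 (leaf 0F 5F 1F 2F true)
 (branch 4F 6F
 (branch 5F 6F
 (leaf 0F 5F 4F 6F true)
 (branch 3F 6F
 (branch 0F 6F
 (leaf 0F 6F 3F 4F true)
 (leaf 6F 0F 2F 4F false))
 (leaf 1F 5F 3F 6F false)))
 (leaf 6F 4F 2F 0F false)))
 (leaf 4F 2F 3F 5F false)))
 (leaf 5F 4F 2F 0F false))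
 (leaf 5F 0F 2F 4F false)))
 (branch 0F 4F
 (branch 2F 5F
 (branch 2F 6F
 (branch 1F 4F
 (branch 1F 5F
 (leaf 4F 1F 2F 5F true)
 (branch 1F 6F
 (leaf 4F 1F 2F 6F true)
 (branch 0F 1F
 (leaf 3F 0F 1F 4F true)
 (branch 0F 5F
 (branch 0F 6F
 (branch 3F 5F
 (leaf 4F 0F 3F 5F true)
 (branch 4F 5F
 (leaf 6F 0F 4F 5F true)
 (leaf 1F 5F 3F 4F false)))
 (leaf 2F 0F 1F 6F false))
 (leaf 2F 0F 1F 5F false)))))
 (leaf 1F 4F 2F 3F false))
 (leaf 6F 2F 3F 4F false))
 (leaf 5F 2F 3F 4F false))
 (leaf 0F 4F 2F 3F false))))
 (branch 0F 4F
 (branch 0F 5F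
 (branch 0F 6F
 (branch 3F 4F
 (branch 3F 5F
 (branch 4F 5F
 (leaf 0F 4F 3F 5F true)
 (branch 3F 6F
 (branch 4F 6F
 (leaf 0F 4F 3F 6F true)
 (branch 5F 6F
 (leaf 0F 5F 3F 6F true)
 (branch 1F 5F
 (branch 0F 1F
 (leaf 3F 5F 1F 0F true)
 (branch 1F 3F
 (leaf 0F 5F 1F 3F true)
 (leaf 2F 0F 1F 3F false)))
 (leaf 1F 5F 4F 6F false))))
 (leaf 6F 3F 2F 0F false)))
 (leaf 5F 3F 2F 0F false))
 (leaf 4F 3F 2F 0F false))
 (leaf 6F 0F 2F 3F false))
 (leaf 5F 0F 2F 3F false))
 (leaf 4F 0F 2F 3F false))))
 (branch 0F 1F
 (branch 1F 3F
 (branch 0F 3F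
 (branch 0F 4F
 (leaf 4F 0F 1F 3F true)
 (branch 0F 5F
 (leaf 5F 0F 1F 3F true)
 (branch 0F 6F
 (leaf 6F 0F 1F 3F true)
 (branch 2F 4F
 (branch 2F 5F
 (branch 2F 6F
 (branch 4F 5F
 (leaf 6F 2F 4F 5F true)
 (leaf 6F 0F 4F 5F false))
 (leaf 4F 0F 2F 6F false))
 (leaf 4F 0F 2F 5F false))
 (leaf 5F 0F 2F 4F false)))))
 (branch 2F 3F
 (branch 2F 4F
 (branch 3F 4F
 (leaf 1F 3F 2F 4F true)
 (branch 2F 5F
 (branch 3F 5F
 (leaf 1F 3F 2F 5F true)
 (branch 4F 5F
 (branch 2F 6F
 (leaf 6F 2F 4F 5F true)
 (branch 0F 6F
 (branch 1F 6F
 (branch 5F 6F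
 (leaf 5F 6F 1F 0F true)
 (branch 3F 6F
 (leaf 0F 6F 1F 3F true)
 (leaf 2F 6F 3F 5F false)))
 (leaf 0F 2F 1F 6F false))
 (leaf 3F 0F 2F 6F false)))
 (branch 0F 5F
 (branch 0F 4F
 (branch 1F 5F
 (leaf 2F 5F 1F 0F true)
 (leaf 1F 5F 3F 4F false))
 (leaf 0F 4F 3F 5F false))
 (leaf 0F 5F 3F 4F false))))
 (branch 0F 5F
 (branch 1F 5F
 (branch 3F 5F
 (leaf 0F 5F 1F 3F true)
 (branch 4F 5F
 (leaf 4F 5F 1F 0F true)
 (leaf 2F 5F 3F 4F false)))
 (leaf 0F 2F 1F 5F false))
 (leaf 3F 0F 2F 5F false))))
 (branch 0F 4F
 (branch 1F 4F
 (branch 3F 4F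
 (leaf 0F 4F 1F 3F true)
 (branch 0F 5F
 (leaf 5F 0F 1F 4F true)
 (branch 2F 5F
 (branch 3F 5F
 (leaf 1F 3F 2F 5F true)
 (branch 4F 5F
 (leaf 5F 4F 1F 0F true)
 (leaf 0F 5F 3F 4F false)))
 (leaf 3F 0F 2F 5F false))))
 (leaf 0F 2F 1F 4F false))
 (leaf 3F 0F 2F 4F false)))
 (branch 0F 4F
 (branch 0F 5F
 (branch 1F 4F
 (leaf 5F 0F 1F 4F true)
 (branch 1F 5F
 (leaf 4F 0F 1F 5F true)
 (branch 2F 4F
 (branch 2F 5F
 (branch 4F 5F
 (leaf 0F 4F 2F 5F true)
 (branch 1F 6F
 (branch 0F 6F
 (leaf 4F 0F 1F 6F true)
 (leaf 6F 0F 2F 3F false))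
 (leaf 6F 1F 4F 5F false)))
 (leaf 0F 2F 1F 5F false))
 (leaf 0F 2F 1F 4F false))))
 (leaf 5F 0F 2F 3F false))
 (leaf 4F 0F 2F 3F false))))
 (branch 2F 3F
 (branch 1F 4F
 (branch 0F 4F
 (branch 0F 5F
 (leaf 5F 0F 1F 4F true)
 (branch 0F 6F
 (leaf 6F 0F 1F 4F true)
 (branch 2F 5F
 (branch 2F 6F
 (branch 2F 4F
 (leaf 2F 4F 1F 0F true)
 (branch 3F 5F
 (leaf 6F 2F 3F 5F true)
 (branch 0F 3F
 (leaf 3F 0F 1F 4F true)
 (leaf 6F 0F 3F 5F false))))
 (leaf 5F 0F 2F 6F false))
 (leaf 6F 0F 2F 5F false))))
 (branch 2F 4F
 (branch 3F 4F
 (leaf 1F 4F 2F 3F true)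
 (branch 2F 5F
 (branch 3F 5F
 (leaf 4F 2F 3F 5F true)
 (branch 4F 5F
 (leaf 1F 4F 2F 5F true)
 (leaf 0F 4F 3F 5F false)))
 (branch 1F 5F
 (branch 0F 5F
 (branch 4F 5F
 (leaf 0F 5F 1F 4F true)
 (branch 3F 5F
 (leaf 3F 5F 1F 0F true)
 (leaf 0F 4F 3F 5F false)))
 (leaf 4F 0F 2F 5F false))
 (leaf 0F 2F 1F 5F false))))
 (branch 0F 5F
 (branch 0F 6F
 (branch 1F 5F
 (leaf 6F 0F 1F 5F true)
 (branch 2F 5F
 (branch 1F 6F
 (leaf 5F 0F 1F 6F true)
 (branch 2F 6F
 (branch 3F 5F
 (leaf 0F 5F 2F 3F true)
 (leaf 6F 1F 3F 5F false))
 (leaf 0F 2F 1F 6F false)))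
 (leaf 0F 2F 1F 5F false)))
 (leaf 6F 0F 2F 4F false))
 (leaf 5F 0F 2F 4F false))))
 (branch 2F 4F
 (branch 3F 4F
 (branch 2F 5F
 (leaf 5F 2F 3F 4F true)
 (branch 1F 5F
 (branch 2F 6F
 (leaf 6F 2F 3F 4F true)
 (branch 1F 6F
 (branch 0F 5F
 (branch 0F 6F
 (leaf 5F 0F 1F 6F true)
 (branch 5F 6F
 (leaf 0F 5F 1F 6F true)
 (leaf 0F 6F 2F 5F false)))
 (branch 0F 6F
 (branch 5F 6F
 (leaf 0F 6F 1F 5F true)
 (leaf 0F 5F 2F 6F false))
 (leaf 5F 0F 2F 6F false)))
 (leaf 0F 2F 1F 6F false)))
 (leaf 0F 2F 1F 5F false)))
 (branch 1F 5F
 (branch 1F 6F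
 (branch 4F 5F
 (branch 0F 5F
 (leaf 4F 5F 1F 0F true)
 (branch 2F 5F
 (leaf 1F 5F 2F 4F true)
 (branch 0F 3F
 (branch 0F 6F
 (leaf 3F 0F 1F 6F true)
 (leaf 6F 0F 2F 5F false))
 (leaf 0F 3F 1F 4F false))))
 (leaf 5F 4F 3F 1F false))
 (leaf 6F 1F 3F 4F false))
 (leaf 5F 1F 3F 4F false)))
 (leaf 0F 2F 1F 4F false)))
 (leaf 0F 2F 1F 3F false)))
 (branch 0F 3F
 (branch 0F 4F
 (branch 0F 5F
 (branch 0F 6F
 (branch 3F 4F
 (leaf 5F 0F 3F 4F true)
 (branch 3F 5F
 (leaf 4F 0F 3F 5F true)
 (branch 3F 6F
 (leaf 4F 0F 3F 6F true)
 (branch 4F 5F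
 (leaf 6F 0F 4F 5F true)
 (leaf 6F 3F 4F 5F false)))))
 (leaf 6F 0F 1F 2F false))
 (leaf 5F 0F 1F 2F false))
 (leaf 4F 0F 1F 2F false))
 (leaf 3F 0F 1F 2F false)))))

certificate₃ : Certificate 7 4
certificate₃ =
 (branch 0F 1F
 (branch 0F 2F
 (branch 1F 2F
 (branch 0F 3F
 (leaf 3F 0F 2F 1F true)
 (branch 0F 4F
 (leaf 4F 0F 2F 1F true)
 (branch 0F 5F
 (leaf 5F 0F 2F 1F true)
 (branch 0F 6F
 (leaf 6F 0F 2F 1F true)
 (branch 3F 4F
 (branch 4F 5F
 (branch 5F 6F
 (branch 4F 6F
 (leaf 3F 4F 5F 6F true)
 (leaf 3F 0F 4F 6F false))
 (leaf 3F 0F 5F 6F false))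
 (leaf 3F 0F 4F 5F false))
 (leaf 5F 0F 4F 3F false))))))
 (branch 0F 3F
 (branch 2F 3F
 (leaf 1F 0F 2F 3F true)
 (branch 1F 3F
 (branch 0F 4F
 (leaf 4F 0F 3F 1F true)
 (branch 0F 5F
 (leaf 5F 0F 3F 1F true)
 (branch 0F 6F
 (leaf 6F 0F 3F 1F true)
 (branch 4F 5F
 (branch 5F 6F
 (branch 1F 5F
 (leaf 5F 1F 3F 0F true)
 (branch 2F 5F
 (branch 2F 6F
 (leaf 0F 2F 5F 6F true)
 (branch 3F 6F
 (branch 4F 6F
 (leaf 3F 6F 5F 4F true)
 (leaf 2F 6F 4F 0F false))
 (leaf 0F 6F 3F 2F false)))
 (leaf 0F 5F 2F 1F false)))
 (leaf 4F 0F 5F 6F false))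
 (leaf 6F 0F 5F 4F false)))))
 (branch 2F 4F
 (branch 0F 4F
 (leaf 1F 0F 2F 4F true)
 (branch 2F 5F
 (branch 0F 5F
 (leaf 1F 0F 2F 5F true)
 (branch 4F 5F
 (leaf 0F 2F 4F 5F true)
 (branch 1F 5F
 (branch 2F 6F
 (branch 5F 6F
 (leaf 0F 2F 5F 6F true)
 (branch 4F 6F
 (leaf 0F 2F 4F 6F true)
 (leaf 0F 4F 5F 6F false)))
 (leaf 6F 2F 3F 1F false))
 (leaf 1F 5F 4F 0F false))))
 (leaf 5F 2F 3F 1F false)))
 (leaf 4F 2F 3F 1F false))))
 (branch 0F 4F
 (branch 2F 4F
 (leaf 1F 0F 2F 4F true)
 (branch 1F 4F
 (branch 0F 5F
 (leaf 5F 0F 4F 1F true)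
 (branch 0F 6F
 (leaf 6F 0F 4F 1F true)
 (branch 5F 6F
 (branch 1F 6F
 (leaf 6F 1F 4F 0F true)
 (branch 2F 6F
 (branch 2F 5F
 (leaf 0F 2F 5F 6F true)
 (branch 1F 5F
 (leaf 5F 1F 4F 0F true)
 (leaf 0F 5F 2F 1F false)))
 (leaf 0F 6F 2F 1F false)))
 (leaf 3F 0F 5F 6F false))))
 (branch 2F 5F
 (branch 0F 5F
 (leaf 1F 0F 2F 5F true)
 (branch 2F 6F
 (branch 0F 6F
 (leaf 1F 0F 2F 6F true)
 (branch 5F 6F
 (leaf 0F 2F 5F 6F true)
 (leaf 3F 0F 5F 6F false)))
 (leaf 6F 2F 4F 1F false)))
 (leaf 5F 2F 4F 1F false))))
 (branch 3F 4F
 (branch 0F 5F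
 (branch 2F 5F
 (leaf 1F 0F 2F 5F true)
 (branch 0F 6F
 (branch 5F 6F
 (leaf 1F 0F 5F 6F true)
 (branch 2F 6F
 (leaf 1F 0F 2F 6F true)
 (leaf 1F 2F 5F 6F false)))
 (branch 4F 6F
 (branch 2F 6F
 (branch 2F 4F
 (leaf 0F 2F 4F 6F true)
 (branch 1F 4F
 (branch 1F 6F
 (leaf 0F 1F 4F 6F true)
 (branch 3F 6F
 (leaf 2F 6F 4F 3F true)
 (leaf 1F 6F 3F 0F false)))
 (leaf 0F 4F 2F 1F false)))
 (branch 5F 6F
 (branch 3F 6F
 (branch 1F 6F
 (leaf 1F 6F 4F 3F true)
 (leaf 0F 6F 2F 1F false))
 (leaf 2F 6F 3F 0F false))
 (leaf 0F 6F 5F 2F false)))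
 (leaf 3F 0F 4F 6F false))))
 (branch 4F 5F
 (branch 3F 5F
 (branch 2F 3F
 (leaf 2F 3F 4F 5F true)
 (branch 1F 3F
 (leaf 1F 3F 4F 5F true)
 (leaf 0F 3F 2F 1F false)))
 (branch 2F 5F
 (branch 2F 4F
 (leaf 0F 2F 4F 5F true)
 (branch 1F 4F
 (branch 1F 5F
 (leaf 0F 1F 4F 5F true)
 (leaf 1F 5F 3F 0F false))
 (leaf 0F 4F 2F 1F false)))
 (leaf 2F 5F 3F 0F false)))
 (leaf 3F 0F 4F 5F false)))
 (branch 2F 4F
 (branch 0F 5F
 (branch 0F 6F
 (branch 5F 6F
 (leaf 1F 0F 5F 6F true)
 (branch 2F 5F
 (leaf 1F 0F 2F 5F true)
 (branch 2F 6F
 (leaf 1F 0F 2F 6F true)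
 (leaf 1F 2F 5F 6F false))))
 (leaf 6F 0F 4F 3F false))
 (leaf 5F 0F 4F 3F false))
 (leaf 2F 4F 3F 0F false))))))
 (branch 0F 3F
 (branch 1F 3F
 (branch 0F 4F
 (leaf 4F 0F 3F 1F true)
 (branch 0F 5F
 (leaf 5F 0F 3F 1F true)
 (branch 0F 6F
 (leaf 6F 0F 3F 1F true)
 (branch 4F 5F
 (branch 5F 6F
 (branch 2F 4F
 (branch 4F 6F
 (leaf 2F 4F 5F 6F true)
 (leaf 2F 0F 4F 6F false))
 (leaf 5F 0F 4F 2F false))
 (leaf 2F 0F 5F 6F false))
 (leaf 2F 0F 4F 5F false)))))
 (branch 0F 4F
 (branch 3F 4F
 (leaf 1F 0F 3F 4F true)
 (branch 1F 4F
 (branch 0F 5F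
 (leaf 5F 0F 4F 1F true)
 (branch 0F 6F
 (leaf 6F 0F 4F 1F true)
 (branch 5F 6F
 (branch 1F 6F
 (leaf 6F 1F 4F 0F true)
 (branch 3F 6F
 (branch 3F 5F
 (leaf 0F 3F 5F 6F true)
 (branch 1F 5F
 (leaf 5F 1F 4F 0F true)
 (leaf 0F 5F 3F 1F false)))
 (leaf 0F 6F 3F 1F false)))
 (leaf 2F 0F 5F 6F false))))
 (branch 3F 5F
 (branch 0F 5F
 (leaf 1F 0F 3F 5F true)
 (branch 3F 6F
 (branch 0F 6F
 (leaf 1F 0F 3F 6F true)
 (branch 5F 6F
 (leaf 0F 3F 5F 6F true)
 (leaf 2F 0F 5F 6F false)))
 (leaf 6F 3F 4F 1F false)))
 (leaf 5F 3F 4F 1F false))))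
 (branch 2F 4F
 (branch 0F 5F
 (branch 3F 5F
 (leaf 1F 0F 3F 5F true)
 (branch 1F 5F
 (branch 0F 6F
 (leaf 6F 0F 5F 1F true)
 (branch 1F 6F
 (leaf 6F 1F 5F 0F true)
 (branch 4F 6F
 (branch 3F 6F
 (branch 2F 6F
 (leaf 3F 6F 4F 2F true)
 (leaf 1F 6F 2F 0F false))
 (leaf 0F 6F 3F 1F false))
 (leaf 1F 6F 4F 0F false))))
 (branch 2F 5F
 (branch 4F 5F
 (leaf 0F 5F 4F 2F true)
 (branch 1F 4F
 (branch 1F 2F
 (leaf 0F 1F 2F 4F true)
 (leaf 2F 1F 3F 5F false))
 (leaf 3F 1F 4F 5F false)))
 (leaf 2F 5F 3F 1F false))))
 (branch 4F 5F
 (branch 2F 5F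
 (branch 1F 5F
 (leaf 1F 5F 4F 2F true)
 (branch 3F 5F
 (leaf 3F 5F 4F 2F true)
 (leaf 0F 5F 3F 1F false)))
 (branch 1F 5F
 (branch 1F 4F
 (leaf 0F 1F 4F 5F true)
 (branch 3F 4F
 (branch 3F 5F
 (leaf 0F 3F 4F 5F true)
 (branch 2F 3F
 (branch 2F 6F
 (leaf 6F 2F 4F 3F true)
 (leaf 6F 2F 5F 0F false))
 (leaf 0F 2F 3F 5F false)))
 (leaf 0F 4F 3F 1F false)))
 (leaf 1F 5F 2F 0F false)))
 (leaf 2F 0F 4F 5F false)))
 (branch 1F 4F
 (branch 0F 5F
 (branch 0F 6F
 (branch 5F 6F
 (leaf 1F 0F 5F 6F true)
 (branch 3F 5F
 (leaf 1F 0F 3F 5F true)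
 (branch 3F 6F
 (leaf 1F 0F 3F 6F true)
 (leaf 1F 3F 5F 6F false))))
 (leaf 6F 0F 4F 2F false))
 (leaf 5F 0F 4F 2F false))
 (leaf 1F 4F 2F 0F false)))))
 (branch 2F 3F
 (branch 0F 4F
 (branch 1F 4F
 (branch 0F 5F
 (leaf 5F 0F 4F 1F true)
 (branch 0F 6F
 (leaf 6F 0F 4F 1F true)
 (branch 5F 6F
 (branch 3F 5F
 (branch 3F 6F
 (leaf 2F 3F 5F 6F true)
 (leaf 2F 0F 3F 6F false))
 (leaf 2F 0F 3F 5F false))
 (leaf 2F 0F 5F 6F false))))
 (branch 0F 5F
 (branch 4F 5F
 (leaf 1F 0F 4F 5F true)
 (branch 1F 5F
 (branch 0F 6F
 (leaf 6F 0F 5F 1F true)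
 (branch 1F 6F
 (leaf 6F 1F 5F 0F true)
 (branch 3F 6F
 (branch 4F 6F
 (branch 3F 4F
 (leaf 2F 3F 4F 6F true)
 (branch 3F 5F
 (branch 1F 3F
 (leaf 0F 1F 3F 5F true)
 (leaf 6F 1F 4F 3F false))
 (leaf 0F 3F 4F 5F false)))
 (leaf 0F 6F 4F 1F false))
 (leaf 1F 6F 3F 0F false))))
 (branch 2F 5F
 (branch 3F 5F
 (leaf 0F 5F 3F 2F true)
 (leaf 3F 5F 4F 1F false))
 (leaf 2F 5F 4F 1F false))))
 (branch 3F 5F
 (branch 2F 5F
 (branch 1F 5F
 (leaf 1F 5F 3F 2F true)
 (branch 4F 5F
 (branch 2F 4F
 (leaf 3F 2F 4F 5F true)
 (branch 3F 4F
 (leaf 2F 3F 4F 5F true)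
 (branch 1F 2F
 (leaf 1F 2F 3F 5F true)
 (leaf 5F 1F 4F 2F false))))
 (leaf 0F 5F 4F 1F false)))
 (branch 1F 5F
 (branch 1F 3F
 (leaf 0F 1F 3F 5F true)
 (branch 0F 6F
 (branch 4F 6F
 (leaf 1F 0F 4F 6F true)
 (branch 1F 6F
 (branch 5F 6F
 (leaf 0F 1F 5F 6F true)
 (branch 2F 6F
 (branch 3F 6F
 (leaf 0F 6F 3F 2F true)
 (branch 3F 4F
 (branch 4F 5F
 (leaf 1F 5F 4F 3F true)
 (leaf 1F 4F 5F 6F false))
 (leaf 0F 3F 4F 6F false)))
 (leaf 0F 2F 5F 6F false)))
 (leaf 3F 1F 4F 6F false)))
 (leaf 6F 0F 5F 2F false)))
 (leaf 1F 5F 2F 0F false)))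
 (leaf 2F 0F 3F 5F false))))
 (branch 3F 4F
 (branch 2F 4F
 (branch 1F 2F
 (leaf 1F 2F 3F 4F true)
 (branch 3F 5F
 (leaf 5F 3F 4F 2F true)
 (branch 0F 5F
 (branch 3F 6F
 (leaf 6F 3F 4F 2F true)
 (branch 0F 6F
 (branch 5F 6F
 (leaf 1F 0F 5F 6F true)
 (leaf 0F 3F 5F 6F false))
 (leaf 2F 0F 3F 6F false)))
 (leaf 2F 0F 3F 5F false))))
 (branch 0F 5F
 (branch 0F 6F
 (branch 5F 6F
 (leaf 1F 0F 5F 6F true)
 (branch 2F 6F
 (branch 3F 6F
 (leaf 0F 6F 3F 2F true)
 (branch 3F 5F
 (branch 2F 5F
 (leaf 0F 5F 3F 2F true)
 (leaf 5F 2F 4F 0F false))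
 (leaf 0F 3F 5F 6F false)))
 (leaf 6F 2F 4F 0F false)))
 (leaf 6F 0F 4F 2F false))
 (leaf 5F 0F 4F 2F false)))
 (leaf 2F 0F 3F 4F false)))
 (branch 0F 4F
 (branch 0F 5F
 (branch 0F 6F
 (branch 4F 5F
 (leaf 1F 0F 4F 5F true)
 (branch 5F 6F
 (leaf 1F 0F 5F 6F true)
 (branch 1F 4F
 (leaf 5F 0F 4F 1F true)
 (branch 4F 6F
 (leaf 1F 0F 4F 6F true)
 (leaf 1F 4F 5F 6F false)))))
 (leaf 6F 0F 3F 2F false))
 (leaf 5F 0F 3F 2F false))
 (leaf 4F 0F 3F 2F false)))))
 (branch 1F 2F
 (branch 1F 3F
 (branch 2F 3F
 (branch 1F 4F
 (leaf 4F 1F 3F 2F true)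
 (branch 1F 5F
 (leaf 5F 1F 3F 2F true)
 (branch 1F 6F
 (leaf 6F 1F 3F 2F true)
 (branch 4F 5F
 (branch 5F 6F
 (branch 0F 4F
 (branch 4F 6F
 (leaf 0F 4F 5F 6F true)
 (leaf 0F 1F 4F 6F false))
 (leaf 5F 1F 4F 0F false))
 (leaf 0F 1F 5F 6F false))
 (leaf 0F 1F 4F 5F false)))))
 (branch 1F 4F
 (branch 3F 4F
 (leaf 2F 1F 3F 4F true)
 (branch 2F 4F
 (branch 1F 5F
 (leaf 5F 1F 4F 2F true)
 (branch 1F 6F
 (leaf 6F 1F 4F 2F true)
 (branch 5F 6F
 (branch 2F 6F
 (leaf 6F 2F 4F 1F true)
 (branch 3F 6F
 (branch 3F 5F
 (leaf 1F 3F 5F 6F true)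
 (branch 2F 5F
 (leaf 5F 2F 4F 1F true)
 (leaf 1F 5F 3F 2F false)))
 (leaf 1F 6F 3F 2F false)))
 (leaf 0F 1F 5F 6F false))))
 (branch 0F 2F
 (branch 3F 5F
 (branch 1F 5F
 (leaf 2F 1F 3F 5F true)
 (branch 3F 6F
 (branch 1F 6F
 (leaf 2F 1F 3F 6F true)
 (branch 5F 6F
 (leaf 1F 3F 5F 6F true)
 (leaf 0F 1F 5F 6F false)))
 (leaf 6F 3F 4F 2F false)))
 (leaf 5F 3F 4F 2F false))
 (leaf 0F 2F 3F 4F false))))
 (branch 0F 4F
 (branch 1F 5F
 (branch 3F 5F
 (leaf 2F 1F 3F 5F true)
 (branch 2F 5F
 (branch 0F 5F
 (leaf 0F 5F 2F 1F true)
 (branch 0F 3F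
 (branch 1F 6F
 (leaf 6F 1F 5F 2F true)
 (branch 4F 6F
 (branch 0F 6F
 (leaf 3F 0F 4F 6F true)
 (branch 5F 6F
 (branch 2F 6F
 (leaf 1F 2F 5F 6F true)
 (branch 3F 6F
 (branch 3F 4F
 (leaf 0F 3F 4F 6F true)
 (branch 4F 5F
 (leaf 0F 4F 5F 6F true)
 (leaf 0F 5F 4F 3F false)))
 (leaf 0F 6F 3F 2F false)))
 (leaf 1F 0F 5F 6F false)))
 (leaf 0F 1F 4F 6F false)))
 (leaf 1F 0F 3F 5F false)))
 (branch 0F 5F
 (branch 4F 5F
 (leaf 1F 5F 4F 0F true)
 (branch 2F 4F
 (branch 3F 4F
 (branch 0F 2F
 (leaf 5F 0F 4F 2F true)
 (leaf 0F 2F 3F 5F false))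
 (leaf 2F 3F 4F 5F false))
 (leaf 3F 2F 4F 5F false)))
 (leaf 0F 5F 3F 2F false))))
 (branch 4F 5F
 (branch 0F 5F
 (branch 2F 5F
 (leaf 2F 5F 4F 0F true)
 (branch 3F 5F
 (leaf 3F 5F 4F 0F true)
 (leaf 1F 5F 3F 2F false)))
 (branch 1F 6F
 (branch 0F 6F
 (branch 3F 6F
 (leaf 0F 6F 3F 1F true)
 (branch 4F 6F
 (leaf 1F 6F 4F 0F true)
 (branch 3F 4F
 (branch 3F 5F
 (leaf 1F 3F 4F 5F true)
 (branch 0F 3F
 (leaf 6F 0F 4F 3F true)
 (leaf 1F 0F 3F 5F false)))
 (leaf 2F 3F 4F 6F false))))
 (leaf 6F 0F 5F 1F false))
 (leaf 6F 1F 5F 0F false)))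
 (leaf 0F 1F 4F 5F false)))
 (branch 1F 5F
 (branch 1F 6F
 (branch 5F 6F
 (leaf 2F 1F 5F 6F true)
 (branch 3F 5F
 (leaf 2F 1F 3F 5F true)
 (branch 3F 6F
 (leaf 2F 1F 3F 6F true)
 (leaf 2F 3F 5F 6F false))))
 (leaf 6F 1F 4F 0F false))
 (leaf 5F 1F 4F 0F false)))))
 (branch 0F 3F
 (branch 1F 4F
 (branch 2F 4F
 (branch 0F 4F
 (leaf 0F 4F 2F 1F true)
 (branch 1F 5F
 (leaf 5F 1F 4F 2F true)
 (branch 1F 6F
 (leaf 6F 1F 4F 2F true)
 (branch 5F 6F
 (branch 3F 5F
 (branch 3F 6F
 (leaf 0F 3F 5F 6F true)
 (leaf 0F 1F 3F 6F false))
 (leaf 0F 1F 3F 5F false))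
 (leaf 0F 1F 5F 6F false)))))
 (branch 1F 5F
 (branch 4F 5F
 (leaf 2F 1F 4F 5F true)
 (branch 2F 5F
 (branch 0F 5F
 (leaf 0F 5F 2F 1F true)
 (branch 0F 4F
 (branch 3F 4F
 (leaf 1F 4F 3F 0F true)
 (branch 3F 5F
 (branch 2F 3F
 (leaf 1F 2F 3F 5F true)
 (branch 2F 6F
 (leaf 6F 2F 5F 1F true)
 (leaf 6F 2F 4F 3F false)))
 (leaf 0F 5F 4F 3F false)))
 (leaf 1F 0F 4F 5F false)))
 (branch 0F 5F
 (branch 3F 5F
 (leaf 1F 5F 3F 0F true)
 (leaf 3F 5F 4F 2F false))
 (leaf 0F 5F 4F 2F false))))
 (branch 3F 5F
 (branch 0F 5F
 (branch 2F 5F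
 (leaf 2F 5F 3F 0F true)
 (branch 4F 5F
 (branch 0F 4F
 (leaf 3F 0F 4F 5F true)
 (branch 0F 2F
 (leaf 2F 0F 3F 5F true)
 (leaf 1F 0F 2F 4F false)))
 (leaf 1F 5F 4F 2F false)))
 (branch 1F 6F
 (branch 0F 6F
 (branch 4F 6F
 (leaf 0F 6F 4F 1F true)
 (branch 3F 6F
 (leaf 1F 6F 3F 0F true)
 (branch 2F 6F
 (leaf 0F 6F 2F 1F true)
 (leaf 3F 6F 4F 2F false))))
 (leaf 6F 0F 5F 1F false))
 (leaf 6F 1F 5F 0F false)))
 (leaf 0F 1F 3F 5F false))))
 (branch 3F 4F
 (branch 0F 4F
 (branch 3F 5F
 (leaf 5F 3F 4F 0F true)
 (branch 1F 5F
 (branch 3F 6F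
 (leaf 6F 3F 4F 0F true)
 (branch 1F 6F
 (branch 5F 6F
 (leaf 2F 1F 5F 6F true)
 (leaf 1F 3F 5F 6F false))
 (leaf 0F 1F 3F 6F false)))
 (leaf 0F 1F 3F 5F false)))
 (branch 1F 5F
 (branch 1F 6F
 (branch 5F 6F
 (leaf 2F 1F 5F 6F true)
 (branch 0F 6F
 (branch 3F 6F
 (leaf 1F 6F 3F 0F true)
 (branch 3F 5F
 (branch 0F 5F
 (leaf 1F 5F 3F 0F true)
 (leaf 5F 0F 4F 1F false))
 (leaf 1F 3F 5F 6F false)))
 (leaf 6F 0F 4F 1F false)))
 (leaf 6F 1F 4F 0F false))
 (leaf 5F 1F 4F 0F false)))
 (leaf 0F 1F 3F 4F false)))
 (branch 1F 4F
 (branch 1F 5F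
 (branch 1F 6F
 (branch 4F 5F
 (leaf 2F 1F 4F 5F true)
 (branch 5F 6F
 (leaf 2F 1F 5F 6F true)
 (branch 2F 4F
 (leaf 5F 1F 4F 2F true)
 (branch 4F 6F
 (leaf 2F 1F 4F 6F true)
 (leaf 2F 4F 5F 6F false)))))
 (leaf 6F 1F 3F 0F false))
 (leaf 5F 1F 3F 0F false))
 (leaf 4F 1F 3F 0F false))))
 (branch 0F 2F
 (branch 1F 3F
 (branch 1F 4F
 (branch 3F 4F
 (branch 0F 4F
 (leaf 0F 4F 3F 1F true)
 (branch 1F 5F
 (leaf 5F 1F 4F 3F true)
 (branch 1F 6F
 (leaf 6F 1F 4F 3F true)
 (branch 5F 6F
 (branch 2F 5F
 (branch 2F 6F
 (leaf 0F 2F 5F 6F true)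
 (leaf 0F 1F 2F 6F false))
 (leaf 0F 1F 2F 5F false))
 (leaf 0F 1F 5F 6F false)))))
 (branch 1F 5F
 (branch 4F 5F
 (leaf 3F 1F 4F 5F true)
 (branch 3F 5F
 (branch 0F 5F
 (leaf 0F 5F 3F 1F true)
 (branch 0F 4F
 (branch 2F 4F
 (leaf 1F 4F 2F 0F true)
 (branch 2F 5F
 (leaf 2F 5F 3F 1F true)
 (leaf 0F 5F 4F 2F false)))
 (leaf 1F 0F 4F 5F false)))
 (branch 0F 3F
 (branch 2F 3F
 (leaf 1F 3F 2F 0F true)
 (leaf 2F 3F 4F 5F false))
 (leaf 0F 3F 4F 5F false))))
 (branch 2F 5F
 (branch 1F 6F
 (branch 4F 6F
 (leaf 3F 1F 4F 6F true)
 (branch 2F 6F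
 (branch 5F 6F
 (leaf 0F 2F 5F 6F true)
 (branch 3F 6F
 (leaf 2F 6F 3F 1F true)
 (branch 0F 6F
 (leaf 1F 6F 2F 0F true)
 (leaf 0F 6F 4F 3F false))))
 (branch 2F 4F
 (branch 0F 4F
 (leaf 1F 4F 2F 0F true)
 (branch 0F 6F
 (branch 3F 6F
 (leaf 0F 6F 3F 1F true)
 (leaf 2F 6F 4F 3F false))
 (leaf 1F 0F 4F 6F false)))
 (leaf 1F 2F 4F 6F false))))
 (branch 5F 6F
 (branch 2F 6F
 (leaf 0F 2F 5F 6F true)
 (leaf 0F 1F 2F 6F false))
 (leaf 0F 1F 5F 6F false)))
 (leaf 0F 1F 2F 5F false))))
 (branch 2F 4F
 (branch 0F 4F
 (branch 2F 5F
 (leaf 5F 2F 4F 0F true)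
 (branch 1F 5F
 (branch 2F 6F
 (leaf 6F 2F 4F 0F true)
 (branch 1F 6F
 (branch 5F 6F
 (leaf 3F 1F 5F 6F true)
 (leaf 1F 2F 5F 6F false))
 (leaf 0F 1F 2F 6F false)))
 (leaf 0F 1F 2F 5F false)))
 (branch 1F 5F
 (branch 1F 6F
 (branch 5F 6F
 (leaf 3F 1F 5F 6F true)
 (branch 0F 6F
 (branch 2F 6F
 (leaf 1F 6F 2F 0F true)
 (branch 2F 5F
 (branch 0F 5F
 (leaf 1F 5F 2F 0F true)
 (leaf 5F 0F 4F 1F false))
 (leaf 1F 2F 5F 6F false)))
 (leaf 6F 0F 4F 1F false)))
 (leaf 6F 1F 4F 0F false))
 (leaf 5F 1F 4F 0F false)))
 (leaf 0F 1F 2F 4F false)))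
 (branch 2F 3F
 (branch 0F 3F
 (branch 2F 4F
 (leaf 4F 2F 3F 0F true)
 (branch 1F 4F
 (branch 2F 5F
 (leaf 5F 2F 3F 0F true)
 (branch 1F 5F
 (branch 4F 5F
 (branch 0F 5F
 (leaf 0F 5F 4F 1F true)
 (branch 2F 6F
 (leaf 6F 2F 3F 0F true)
 (branch 5F 6F
 (branch 4F 6F
 (leaf 1F 4F 5F 6F true)
 (leaf 1F 2F 4F 6F false))
 (leaf 1F 2F 5F 6F false))))
 (leaf 1F 2F 4F 5F false))
 (leaf 0F 1F 2F 5F false)))
 (leaf 0F 1F 2F 4F false)))
 (branch 1F 4F
 (branch 1F 5F
 (branch 1F 6F
 (branch 4F 5F
 (leaf 6F 1F 5F 4F true)
 (branch 5F 6F
 (leaf 4F 1F 5F 6F true)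
 (branch 0F 5F
 (branch 2F 5F
 (leaf 1F 5F 2F 0F true)
 (branch 2F 6F
 (branch 3F 6F
 (leaf 0F 2F 3F 6F true)
 (branch 4F 6F
 (leaf 2F 6F 4F 1F true)
 (leaf 3F 6F 5F 4F false)))
 (leaf 1F 2F 5F 6F false)))
 (leaf 5F 0F 3F 1F false))))
 (leaf 6F 1F 3F 0F false))
 (leaf 5F 1F 3F 0F false))
 (leaf 4F 1F 3F 0F false)))
 (leaf 0F 1F 2F 3F false)))
 (branch 1F 3F
 (branch 1F 4F
 (branch 1F 5F
 (branch 1F 6F
 (branch 3F 4F
 (leaf 5F 1F 4F 3F true)
 (branch 4F 5F
 (leaf 3F 1F 4F 5F true)
 (branch 5F 6F
 (leaf 3F 1F 5F 6F true)
 (branch 4F 6F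
 (leaf 3F 1F 4F 6F true)
 (leaf 3F 4F 5F 6F false)))))
 (leaf 6F 1F 2F 0F false))
 (leaf 5F 1F 2F 0F false))
 (leaf 4F 1F 2F 0F false))
 (leaf 3F 1F 2F 0F false)))))

certificate₄ : Certificate 7 4
certificate₄ =
 (branch 0F 1F
 (branch 1F 6F
 (branch 0F 6F
 (branch 1F 5F
 (leaf 5F 1F 6F 0F true)
 (branch 1F 4F
 (leaf 4F 1F 6F 0F true)
 (branch 1F 3F
 (leaf 3F 1F 6F 0F true)
 (branch 1F 2F
 (leaf 2F 1F 6F 0F true)
 (branch 2F 5F
 (branch 3F 5F
 (branch 4F 5F
 (branch 2F 4F
 (branch 3F 4F
 (leaf 2F 4F 5F 3F true)
 (leaf 2F 1F 4F 3F false))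
 (leaf 3F 1F 4F 2F false))
 (leaf 2F 1F 5F 4F false))
 (leaf 2F 1F 5F 3F false))
 (leaf 3F 1F 5F 2F false))))))
 (branch 1F 5F
 (branch 5F 6F
 (leaf 0F 1F 6F 5F true)
 (branch 0F 5F
 (branch 1F 4F
 (leaf 4F 1F 5F 0F true)
 (branch 1F 3F
 (leaf 3F 1F 5F 0F true)
 (branch 1F 2F
 (leaf 2F 1F 5F 0F true)
 (branch 0F 2F
 (leaf 2F 0F 5F 1F true)
 (branch 2F 4F
 (branch 0F 3F
 (leaf 3F 0F 5F 1F true)
 (branch 3F 6F
 (branch 2F 6F
 (branch 2F 3F
 (leaf 4F 2F 6F 3F true)
 (leaf 0F 2F 3F 1F false))
 (leaf 1F 2F 6F 0F false))
 (leaf 1F 3F 6F 0F false)))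
 (leaf 0F 2F 4F 1F false))))))
 (branch 2F 5F
 (branch 1F 2F
 (leaf 0F 1F 5F 2F true)
 (branch 3F 5F
 (branch 1F 3F
 (leaf 0F 1F 5F 3F true)
 (branch 0F 2F
 (branch 2F 3F
 (leaf 0F 2F 5F 3F true)
 (branch 0F 4F
 (branch 1F 4F
 (leaf 2F 0F 4F 1F true)
 (branch 2F 4F
 (leaf 1F 0F 4F 2F true)
 (leaf 3F 1F 4F 2F false)))
 (leaf 4F 0F 6F 5F false)))
 (leaf 2F 0F 6F 5F false)))
 (leaf 3F 5F 6F 0F false)))
 (leaf 2F 5F 6F 0F false))))
 (branch 1F 4F
 (branch 4F 6F
 (leaf 0F 1F 6F 4F true)
 (branch 0F 4F
 (branch 1F 3F
 (leaf 3F 1F 4F 0F true)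
 (branch 1F 2F
 (leaf 2F 1F 4F 0F true)
 (branch 0F 2F
 (leaf 2F 0F 4F 1F true)
 (branch 2F 5F
 (branch 0F 3F
 (leaf 3F 0F 4F 1F true)
 (branch 3F 6F
 (branch 2F 6F
 (branch 2F 3F
 (leaf 5F 2F 6F 3F true)
 (leaf 0F 2F 3F 1F false))
 (leaf 1F 2F 6F 0F false))
 (leaf 1F 3F 6F 0F false)))
 (leaf 0F 2F 5F 1F false)))))
 (branch 2F 4F
 (branch 1F 2F
 (leaf 0F 1F 4F 2F true)
 (branch 0F 2F
 (branch 4F 5F
 (branch 2F 5F
 (leaf 0F 2F 5F 4F true)
 (branch 3F 4F
 (branch 1F 3F
 (leaf 0F 1F 4F 3F true)
 (leaf 3F 1F 5F 2F false))
 (leaf 3F 4F 6F 0F false)))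
 (leaf 5F 4F 6F 0F false))
 (leaf 2F 0F 6F 4F false)))
 (leaf 2F 4F 6F 0F false))))
 (branch 4F 5F
 (branch 1F 3F
 (branch 3F 6F
 (leaf 0F 1F 6F 3F true)
 (branch 0F 3F
 (branch 1F 2F
 (leaf 2F 1F 3F 0F true)
 (branch 0F 2F
 (leaf 2F 0F 3F 1F true)
 (branch 2F 5F
 (branch 2F 6F
 (branch 2F 4F
 (branch 4F 6F
 (leaf 5F 2F 6F 4F true)
 (branch 0F 4F
 (leaf 0F 4F 5F 2F true)
 (leaf 1F 4F 6F 0F false)))
 (leaf 0F 2F 4F 1F false))
 (leaf 1F 2F 6F 0F false))
 (leaf 0F 2F 5F 1F false))))
 (branch 3F 4F
 (branch 3F 5F
 (leaf 1F 3F 5F 4F true)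
 (leaf 5F 3F 6F 0F false))
 (leaf 4F 3F 6F 0F false))))
 (branch 3F 5F
 (branch 3F 4F
 (branch 0F 3F
 (leaf 0F 3F 5F 4F true)
 (branch 3F 6F
 (branch 4F 6F
 (leaf 5F 3F 6F 4F true)
 (branch 0F 4F
 (leaf 0F 4F 5F 3F true)
 (leaf 1F 4F 6F 0F false)))
 (leaf 1F 3F 6F 0F false)))
 (branch 0F 3F
 (branch 0F 5F
 (leaf 1F 0F 5F 3F true)
 (branch 5F 6F
 (branch 3F 6F
 (leaf 0F 3F 6F 5F true)
 (branch 4F 6F
 (leaf 3F 5F 6F 4F true)
 (leaf 1F 3F 6F 4F false)))
 (leaf 1F 5F 6F 0F false)))
 (leaf 0F 3F 4F 1F false)))
 (leaf 4F 1F 5F 3F false)))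
 (branch 0F 4F
 (branch 1F 3F
 (branch 1F 2F
 (branch 2F 6F
 (leaf 0F 1F 6F 2F true)
 (branch 3F 6F
 (leaf 0F 1F 6F 3F true)
 (branch 0F 3F
 (leaf 2F 1F 3F 0F true)
 (branch 2F 3F
 (leaf 0F 1F 3F 2F true)
 (leaf 0F 3F 6F 2F false)))))
 (leaf 2F 1F 5F 4F false))
 (leaf 3F 1F 5F 4F false))
 (leaf 0F 4F 5F 1F false))))))
 (branch 1F 5F
 (branch 0F 5F
 (branch 1F 4F
 (leaf 4F 1F 5F 0F true)
 (branch 1F 3F
 (leaf 3F 1F 5F 0F true)
 (branch 1F 2F
 (leaf 2F 1F 5F 0F true)
 (branch 2F 6F
 (branch 3F 6F
 (branch 4F 6F
 (branch 2F 4F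
 (branch 3F 4F
 (leaf 2F 4F 6F 3F true)
 (leaf 2F 1F 4F 3F false))
 (leaf 3F 1F 4F 2F false))
 (leaf 2F 1F 6F 4F false))
 (leaf 2F 1F 6F 3F false))
 (leaf 3F 1F 6F 2F false)))))
 (branch 1F 4F
 (branch 4F 5F
 (leaf 0F 1F 5F 4F true)
 (branch 0F 4F
 (branch 1F 3F
 (leaf 3F 1F 4F 0F true)
 (branch 1F 2F
 (leaf 2F 1F 4F 0F true)
 (branch 0F 2F
 (leaf 2F 0F 4F 1F true)
 (branch 2F 6F
 (branch 0F 3F
 (leaf 3F 0F 4F 1F true)
 (branch 3F 6F
 (branch 2F 3F
 (branch 2F 5F
 (leaf 5F 2F 6F 3F true)
 (leaf 1F 2F 5F 0F false))
 (leaf 0F 2F 3F 1F false))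
 (leaf 0F 3F 6F 1F false)))
 (leaf 0F 2F 6F 1F false)))))
 (branch 2F 4F
 (branch 1F 2F
 (leaf 0F 1F 4F 2F true)
 (branch 0F 2F
 (branch 3F 4F
 (branch 1F 3F
 (leaf 0F 1F 4F 3F true)
 (branch 2F 6F
 (branch 4F 6F
 (leaf 0F 2F 6F 4F true)
 (branch 0F 6F
 (leaf 1F 0F 6F 2F true)
 (leaf 5F 0F 6F 4F false)))
 (leaf 3F 1F 6F 2F false)))
 (leaf 3F 4F 5F 0F false))
 (leaf 2F 0F 5F 4F false)))
 (leaf 2F 4F 5F 0F false))))
 (branch 4F 6F
 (branch 1F 3F
 (branch 3F 5F
 (leaf 0F 1F 5F 3F true)
 (branch 0F 3F
 (branch 1F 2F
 (leaf 2F 1F 3F 0F true)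
 (branch 2F 6F
 (branch 0F 2F
 (leaf 2F 0F 3F 1F true)
 (branch 2F 4F
 (branch 2F 5F
 (leaf 5F 2F 6F 4F true)
 (leaf 1F 2F 5F 0F false))
 (leaf 0F 2F 4F 1F false)))
 (leaf 4F 1F 6F 2F false)))
 (branch 3F 4F
 (branch 3F 6F
 (leaf 1F 3F 6F 4F true)
 (branch 5F 6F
 (branch 4F 5F
 (leaf 1F 5F 6F 4F true)
 (branch 0F 4F
 (branch 0F 6F
 (leaf 1F 0F 6F 4F true)
 (leaf 5F 0F 6F 3F false))
 (leaf 1F 4F 5F 0F false)))
 (leaf 0F 3F 6F 5F false)))
 (leaf 4F 3F 5F 0F false))))
 (branch 3F 6F
 (branch 3F 4F
 (branch 0F 3F
 (leaf 0F 3F 6F 4F true)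
 (branch 3F 5F
 (leaf 5F 3F 6F 4F true)
 (leaf 1F 3F 5F 0F false)))
 (branch 0F 3F
 (branch 0F 6F
 (leaf 1F 0F 6F 3F true)
 (branch 1F 2F
 (branch 2F 3F
 (branch 2F 6F
 (leaf 0F 3F 6F 2F true)
 (branch 0F 2F
 (leaf 1F 0F 3F 2F true)
 (leaf 5F 0F 6F 2F false)))
 (leaf 2F 3F 4F 1F false))
 (leaf 2F 1F 4F 3F false)))
 (leaf 0F 3F 4F 1F false)))
 (leaf 4F 1F 6F 3F false)))
 (branch 0F 4F
 (branch 1F 3F
 (branch 1F 2F
 (branch 2F 5F
 (leaf 0F 1F 5F 2F true)
 (branch 3F 5F
 (leaf 0F 1F 5F 3F true)
 (branch 0F 3F
 (leaf 2F 1F 3F 0F true)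
 (branch 2F 3F
 (leaf 0F 1F 3F 2F true)
 (leaf 0F 3F 5F 2F false)))))
 (leaf 2F 1F 6F 4F false))
 (leaf 3F 1F 6F 4F false))
 (leaf 0F 4F 6F 1F false)))))
 (branch 5F 6F
 (branch 1F 4F
 (branch 0F 4F
 (branch 1F 3F
 (leaf 3F 1F 4F 0F true)
 (branch 1F 2F
 (leaf 2F 1F 4F 0F true)
 (branch 2F 6F
 (branch 3F 6F
 (branch 2F 5F
 (branch 3F 5F
 (leaf 2F 5F 6F 3F true)
 (leaf 2F 1F 5F 3F false))
 (leaf 3F 1F 5F 2F false))
 (leaf 2F 1F 6F 3F false))
 (leaf 3F 1F 6F 2F false))))
 (branch 1F 3F
 (branch 3F 4F
 (leaf 0F 1F 4F 3F true)
 (branch 1F 2F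
 (branch 2F 4F
 (leaf 0F 1F 4F 2F true)
 (branch 2F 3F
 (leaf 0F 1F 3F 2F true)
 (branch 0F 3F
 (leaf 2F 1F 3F 0F true)
 (leaf 0F 3F 4F 2F false))))
 (branch 2F 6F
 (branch 2F 5F
 (branch 0F 2F
 (leaf 0F 2F 6F 5F true)
 (branch 2F 4F
 (leaf 4F 2F 6F 5F true)
 (leaf 1F 2F 4F 0F false)))
 (branch 0F 2F
 (branch 2F 3F
 (branch 3F 6F
 (leaf 0F 2F 6F 3F true)
 (branch 0F 6F
 (leaf 1F 0F 6F 2F true)
 (branch 0F 3F
 (leaf 1F 0F 3F 2F true)
 (leaf 4F 0F 6F 3F false))))
 (leaf 3F 2F 5F 1F false))
 (leaf 0F 2F 5F 1F false)))
 (leaf 5F 1F 6F 2F false))))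
 (branch 3F 6F
 (branch 3F 5F
 (branch 0F 3F
 (leaf 0F 3F 6F 5F true)
 (branch 3F 4F
 (leaf 4F 3F 6F 5F true)
 (leaf 1F 3F 4F 0F false)))
 (branch 0F 3F
 (branch 0F 6F
 (leaf 1F 0F 6F 3F true)
 (branch 3F 4F
 (branch 4F 6F
 (leaf 0F 3F 6F 4F true)
 (branch 2F 3F
 (branch 2F 6F
 (leaf 0F 3F 6F 2F true)
 (branch 2F 4F
 (leaf 0F 3F 4F 2F true)
 (leaf 0F 4F 6F 2F false)))
 (leaf 2F 3F 5F 1F false)))
 (leaf 4F 3F 5F 1F false)))
 (leaf 0F 3F 5F 1F false)))
 (leaf 5F 1F 6F 3F false))))
 (branch 4F 6F
 (branch 4F 5F
 (branch 0F 4F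
 (leaf 0F 4F 6F 5F true)
 (branch 2F 5F
 (leaf 2F 5F 6F 4F true)
 (branch 1F 2F
 (branch 3F 5F
 (leaf 3F 5F 6F 4F true)
 (branch 1F 3F
 (branch 2F 3F
 (leaf 0F 1F 3F 2F true)
 (branch 0F 3F
 (leaf 2F 1F 3F 0F true)
 (leaf 0F 3F 5F 2F false)))
 (leaf 4F 1F 5F 3F false)))
 (leaf 4F 1F 5F 2F false))))
 (branch 1F 3F
 (branch 1F 2F
 (branch 2F 4F
 (branch 2F 6F
 (leaf 1F 2F 6F 4F true)
 (branch 3F 4F
 (branch 2F 3F
 (leaf 0F 1F 3F 2F true)
 (branch 3F 6F
 (leaf 1F 3F 6F 4F true)
 (branch 0F 3F
 (leaf 2F 1F 3F 0F true)
 (leaf 0F 3F 6F 2F false))))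
 (leaf 3F 4F 5F 1F false)))
 (leaf 2F 4F 5F 1F false))
 (leaf 2F 1F 5F 4F false))
 (leaf 3F 1F 5F 4F false)))
 (leaf 5F 1F 6F 4F false)))
 (branch 1F 4F
 (branch 1F 3F
 (branch 1F 2F
 (branch 2F 4F
 (leaf 0F 1F 4F 2F true)
 (branch 3F 4F
 (leaf 0F 1F 4F 3F true)
 (branch 0F 4F
 (leaf 2F 1F 4F 0F true)
 (branch 4F 5F
 (branch 2F 3F
 (leaf 0F 1F 3F 2F true)
 (branch 0F 3F
 (leaf 2F 1F 3F 0F true)
 (leaf 0F 3F 4F 2F false)))
 (leaf 4F 5F 6F 1F false)))))
 (leaf 2F 1F 6F 5F false))
 (leaf 3F 1F 6F 5F false))
 (leaf 4F 1F 6F 5F false)))))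
 (branch 1F 6F
 (branch 1F 5F
 (branch 5F 6F
 (branch 1F 4F
 (leaf 4F 1F 6F 5F true)
 (branch 1F 3F
 (leaf 3F 1F 6F 5F true)
 (branch 1F 2F
 (leaf 2F 1F 6F 5F true)
 (branch 2F 4F
 (branch 3F 4F
 (branch 0F 4F
 (branch 4F 5F
 (leaf 4F 5F 6F 1F true)
 (branch 2F 3F
 (branch 0F 3F
 (leaf 0F 3F 4F 2F true)
 (leaf 2F 1F 3F 0F false))
 (leaf 0F 1F 3F 2F false)))
 (leaf 2F 1F 4F 0F false))
 (leaf 0F 1F 4F 3F false))
 (leaf 0F 1F 4F 2F false)))))
 (branch 1F 4F
 (branch 4F 6F
 (leaf 5F 1F 6F 4F true)
 (branch 4F 5F
 (branch 1F 3F
 (leaf 3F 1F 5F 4F true)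
 (branch 1F 2F
 (leaf 2F 1F 5F 4F true)
 (branch 2F 4F
 (leaf 2F 4F 5F 1F true)
 (branch 2F 6F
 (branch 3F 4F
 (leaf 3F 4F 5F 1F true)
 (branch 2F 3F
 (branch 3F 6F
 (branch 0F 3F
 (leaf 0F 3F 6F 2F true)
 (leaf 2F 1F 3F 0F false))
 (leaf 1F 3F 6F 4F false))
 (leaf 0F 1F 3F 2F false)))
 (leaf 1F 2F 6F 4F false)))))
 (branch 0F 4F
 (branch 2F 5F
 (branch 1F 2F
 (leaf 4F 1F 5F 2F true)
 (branch 3F 5F
 (branch 1F 3F
 (leaf 4F 1F 5F 3F true)
 (branch 2F 3F
 (branch 0F 3F
 (leaf 0F 3F 5F 2F true)
 (leaf 2F 1F 3F 0F false))
 (leaf 0F 1F 3F 2F false)))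
 (leaf 3F 5F 6F 4F false)))
 (leaf 2F 5F 6F 4F false))
 (leaf 0F 4F 6F 5F false))))
 (branch 0F 4F
 (branch 1F 3F
 (branch 3F 6F
 (leaf 5F 1F 6F 3F true)
 (branch 3F 5F
 (branch 0F 3F
 (leaf 0F 3F 5F 1F true)
 (branch 0F 6F
 (branch 3F 4F
 (leaf 4F 3F 5F 1F true)
 (branch 4F 6F
 (branch 2F 3F
 (leaf 2F 3F 5F 1F true)
 (branch 2F 6F
 (branch 2F 4F
 (leaf 0F 4F 6F 2F true)
 (leaf 0F 3F 4F 2F false))
 (leaf 0F 3F 6F 2F false)))
 (leaf 0F 3F 6F 4F false)))
 (leaf 1F 0F 6F 3F false)))
 (branch 0F 3F
 (branch 3F 4F
 (leaf 1F 3F 4F 0F true)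
 (leaf 4F 3F 6F 5F false))
 (leaf 0F 3F 6F 5F false))))
 (branch 3F 4F
 (branch 1F 2F
 (branch 2F 6F
 (leaf 5F 1F 6F 2F true)
 (branch 2F 5F
 (branch 0F 2F
 (leaf 0F 2F 5F 1F true)
 (branch 2F 3F
 (leaf 3F 2F 5F 1F true)
 (branch 3F 6F
 (branch 0F 6F
 (branch 0F 3F
 (leaf 4F 0F 6F 3F true)
 (leaf 1F 0F 3F 2F false))
 (leaf 1F 0F 6F 2F false))
 (leaf 0F 2F 6F 3F false))))
 (branch 0F 2F
 (branch 2F 4F
 (leaf 1F 2F 4F 0F true)
 (leaf 4F 2F 6F 5F false))
 (leaf 0F 2F 6F 5F false))))
 (branch 2F 4F
 (branch 2F 3F
 (branch 0F 3F
 (leaf 0F 3F 4F 2F true)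
 (leaf 2F 1F 3F 0F false))
 (leaf 0F 1F 3F 2F false))
 (leaf 0F 1F 4F 2F false)))
 (leaf 0F 1F 4F 3F false)))
 (branch 1F 3F
 (branch 1F 2F
 (branch 2F 6F
 (leaf 3F 1F 6F 2F true)
 (branch 3F 6F
 (leaf 2F 1F 6F 3F true)
 (branch 2F 5F
 (leaf 3F 1F 5F 2F true)
 (branch 3F 5F
 (leaf 2F 1F 5F 3F true)
 (leaf 2F 5F 6F 3F false)))))
 (leaf 2F 1F 4F 0F false))
 (leaf 3F 1F 4F 0F false)))))
 (branch 0F 5F
 (branch 1F 4F
 (branch 4F 6F
 (branch 0F 4F
 (leaf 0F 4F 6F 1F true)
 (branch 1F 3F
 (leaf 3F 1F 6F 4F true)
 (branch 1F 2F
 (leaf 2F 1F 6F 4F true)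
 (branch 2F 5F
 (branch 3F 5F
 (branch 0F 3F
 (branch 2F 3F
 (leaf 0F 3F 5F 2F true)
 (leaf 0F 1F 3F 2F false))
 (leaf 2F 1F 3F 0F false))
 (leaf 0F 1F 5F 3F false))
 (leaf 0F 1F 5F 2F false)))))
 (branch 1F 3F
 (branch 3F 6F
 (leaf 4F 1F 6F 3F true)
 (branch 3F 4F
 (branch 0F 3F
 (leaf 0F 3F 4F 1F true)
 (branch 0F 6F
 (branch 1F 2F
 (leaf 2F 1F 4F 3F true)
 (branch 2F 3F
 (leaf 2F 3F 4F 1F true)
 (branch 2F 6F
 (branch 0F 2F
 (leaf 5F 0F 6F 2F true)
 (leaf 1F 0F 3F 2F false))
 (leaf 0F 3F 6F 2F false))))
 (leaf 1F 0F 6F 3F false)))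
 (branch 0F 3F
 (branch 3F 5F
 (leaf 1F 3F 5F 0F true)
 (leaf 5F 3F 6F 4F false))
 (leaf 0F 3F 6F 4F false))))
 (branch 3F 5F
 (branch 0F 3F
 (branch 3F 4F
 (leaf 4F 3F 5F 0F true)
 (branch 3F 6F
 (branch 5F 6F
 (leaf 0F 3F 6F 5F true)
 (branch 4F 5F
 (branch 0F 4F
 (leaf 1F 4F 5F 0F true)
 (branch 0F 6F
 (leaf 5F 0F 6F 3F true)
 (leaf 1F 0F 6F 4F false)))
 (leaf 1F 5F 6F 4F false)))
 (leaf 1F 3F 6F 4F false)))
 (branch 1F 2F
 (branch 2F 6F
 (leaf 4F 1F 6F 2F true)
 (branch 0F 2F
 (branch 2F 4F
 (leaf 0F 2F 4F 1F true)
 (branch 2F 5F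
 (leaf 1F 2F 5F 0F true)
 (leaf 5F 2F 6F 4F false)))
 (leaf 2F 0F 3F 1F false)))
 (leaf 2F 1F 3F 0F false)))
 (leaf 0F 1F 5F 3F false))))
 (branch 4F 5F
 (branch 0F 4F
 (branch 2F 4F
 (leaf 2F 4F 5F 0F true)
 (branch 1F 2F
 (branch 0F 2F
 (leaf 2F 0F 5F 4F true)
 (branch 3F 4F
 (leaf 3F 4F 5F 0F true)
 (branch 1F 3F
 (branch 2F 6F
 (leaf 3F 1F 6F 2F true)
 (branch 4F 6F
 (branch 0F 6F
 (leaf 5F 0F 6F 4F true)
 (leaf 1F 0F 6F 2F false))
 (leaf 0F 2F 6F 4F false)))
 (leaf 0F 1F 4F 3F false))))
 (leaf 0F 1F 4F 2F false)))
 (branch 1F 3F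
 (branch 1F 2F
 (branch 0F 2F
 (branch 2F 6F
 (leaf 0F 2F 6F 1F true)
 (branch 0F 3F
 (branch 3F 6F
 (leaf 0F 3F 6F 1F true)
 (branch 2F 3F
 (leaf 0F 2F 3F 1F true)
 (branch 2F 5F
 (leaf 1F 2F 5F 0F true)
 (leaf 5F 2F 6F 3F false))))
 (leaf 3F 0F 4F 1F false)))
 (leaf 2F 0F 4F 1F false))
 (leaf 2F 1F 4F 0F false))
 (leaf 3F 1F 4F 0F false)))
 (leaf 0F 1F 5F 4F false)))
 (branch 1F 4F
 (branch 1F 3F
 (branch 1F 2F
 (branch 2F 6F
 (leaf 3F 1F 6F 2F true)
 (branch 3F 6F
 (leaf 2F 1F 6F 3F true)
 (branch 4F 6F
 (leaf 2F 1F 6F 4F true)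
 (branch 2F 4F
 (leaf 3F 1F 4F 2F true)
 (branch 3F 4F
 (leaf 2F 1F 4F 3F true)
 (leaf 2F 4F 6F 3F false))))))
 (leaf 2F 1F 5F 0F false))
 (leaf 3F 1F 5F 0F false))
 (leaf 4F 1F 5F 0F false))))
 (branch 0F 6F
 (branch 1F 5F
 (branch 1F 4F
 (branch 4F 5F
 (branch 0F 4F
 (leaf 0F 4F 5F 1F true)
 (branch 1F 3F
 (leaf 3F 1F 5F 4F true)
 (branch 1F 2F
 (leaf 2F 1F 5F 4F true)
 (branch 2F 6F
 (branch 3F 6F
 (branch 0F 3F
 (branch 2F 3F
 (leaf 0F 3F 6F 2F true)
 (leaf 0F 1F 3F 2F false))
 (leaf 2F 1F 3F 0F false))
 (leaf 0F 1F 6F 3F false))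
 (leaf 0F 1F 6F 2F false)))))
 (branch 1F 3F
 (branch 3F 5F
 (leaf 4F 1F 5F 3F true)
 (branch 3F 4F
 (branch 0F 3F
 (leaf 0F 3F 4F 1F true)
 (branch 0F 5F
 (branch 5F 6F
 (leaf 1F 5F 6F 0F true)
 (branch 3F 6F
 (branch 4F 6F
 (leaf 1F 3F 6F 4F true)
 (leaf 3F 5F 6F 4F false))
 (leaf 0F 3F 6F 5F false)))
 (leaf 1F 0F 5F 3F false)))
 (branch 0F 3F
 (branch 3F 6F
 (leaf 1F 3F 6F 0F true)
 (branch 4F 6F
 (branch 0F 4F
 (leaf 1F 4F 6F 0F true)
 (leaf 0F 4F 5F 3F false))
 (leaf 5F 3F 6F 4F false)))
 (leaf 0F 3F 5F 4F false))))
 (branch 3F 6F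
 (branch 0F 3F
 (branch 3F 4F
 (leaf 4F 3F 6F 0F true)
 (branch 3F 5F
 (leaf 5F 3F 6F 0F true)
 (leaf 1F 3F 5F 4F false)))
 (branch 1F 2F
 (branch 0F 2F
 (branch 2F 5F
 (leaf 0F 2F 5F 1F true)
 (branch 2F 6F
 (leaf 1F 2F 6F 0F true)
 (branch 2F 4F
 (leaf 0F 2F 4F 1F true)
 (branch 4F 6F
 (branch 0F 4F
 (leaf 1F 4F 6F 0F true)
 (leaf 0F 4F 5F 2F false))
 (leaf 5F 2F 6F 4F false)))))
 (leaf 2F 0F 3F 1F false))
 (leaf 2F 1F 3F 0F false)))
 (leaf 0F 1F 6F 3F false))))
 (branch 4F 6F
 (branch 0F 4F
 (branch 2F 4F
 (leaf 2F 4F 6F 0F true)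
 (branch 1F 2F
 (branch 0F 2F
 (leaf 2F 0F 6F 4F true)
 (branch 4F 5F
 (leaf 5F 4F 6F 0F true)
 (branch 2F 5F
 (branch 3F 4F
 (leaf 3F 4F 6F 0F true)
 (branch 1F 3F
 (leaf 3F 1F 5F 2F true)
 (leaf 0F 1F 4F 3F false)))
 (leaf 0F 2F 5F 4F false))))
 (leaf 0F 1F 4F 2F false)))
 (branch 1F 3F
 (branch 1F 2F
 (branch 0F 2F
 (branch 2F 5F
 (leaf 0F 2F 5F 1F true)
 (branch 0F 3F
 (branch 3F 6F
 (leaf 1F 3F 6F 0F true)
 (branch 2F 6F
 (leaf 1F 2F 6F 0F true)
 (branch 2F 3F
 (leaf 0F 2F 3F 1F true)
 (leaf 5F 2F 6F 3F false))))
 (leaf 3F 0F 4F 1F false)))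
 (leaf 2F 0F 4F 1F false))
 (leaf 2F 1F 4F 0F false))
 (leaf 3F 1F 4F 0F false)))
 (leaf 0F 1F 6F 4F false)))
 (branch 5F 6F
 (branch 0F 5F
 (branch 2F 5F
 (leaf 2F 5F 6F 0F true)
 (branch 1F 2F
 (branch 3F 5F
 (leaf 3F 5F 6F 0F true)
 (branch 1F 3F
 (branch 0F 2F
 (leaf 2F 0F 6F 5F true)
 (branch 2F 3F
 (branch 0F 4F
 (leaf 4F 0F 6F 5F true)
 (branch 1F 4F
 (branch 2F 4F
 (leaf 3F 1F 4F 2F true)
 (leaf 1F 0F 4F 2F false))
 (leaf 2F 0F 4F 1F false)))
 (leaf 0F 2F 5F 3F false)))
 (leaf 0F 1F 5F 3F false)))
 (leaf 0F 1F 5F 2F false)))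
 (branch 1F 4F
 (branch 1F 3F
 (branch 1F 2F
 (branch 0F 2F
 (branch 2F 4F
 (leaf 0F 2F 4F 1F true)
 (branch 0F 3F
 (branch 3F 6F
 (leaf 1F 3F 6F 0F true)
 (branch 2F 6F
 (leaf 1F 2F 6F 0F true)
 (branch 2F 3F
 (leaf 0F 2F 3F 1F true)
 (leaf 4F 2F 6F 3F false))))
 (leaf 3F 0F 5F 1F false)))
 (leaf 2F 0F 5F 1F false))
 (leaf 2F 1F 5F 0F false))
 (leaf 3F 1F 5F 0F false))
 (leaf 4F 1F 5F 0F false)))
 (leaf 0F 1F 6F 5F false)))
 (branch 1F 5F
 (branch 1F 4F
 (branch 1F 3F
 (branch 1F 2F
 (branch 2F 5F
 (leaf 3F 1F 5F 2F true)
 (branch 3F 5F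
 (leaf 2F 1F 5F 3F true)
 (branch 4F 5F
 (leaf 2F 1F 5F 4F true)
 (branch 2F 4F
 (leaf 3F 1F 4F 2F true)
 (branch 3F 4F
 (leaf 2F 1F 4F 3F true)
 (leaf 2F 4F 5F 3F false))))))
 (leaf 2F 1F 6F 0F false))
 (leaf 3F 1F 6F 0F false))
 (leaf 4F 1F 6F 0F false))
 (leaf 5F 1F 6F 0F false)))))

ramseyHolds-pan3-7 : (l : Fin 4) → RamseyHolds pan3 (pointOrdering pan3 e₃ l) 7
ramseyHolds-pan3-7 0F = ramseyHolds-fromCertificate pan3 panAdj? _ certificate₁ _
ramseyHolds-pan3-7 1F = ramseyHolds-fromCertificate pan3 panAdj? _ certificate₂ _
ramseyHolds-pan3-7 2F = ramseyHolds-fromCertificate pan3 panAdj? _ certificate₃ _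
ramseyHolds-pan3-7 3F = ramseyHolds-fromCertificate pan3 panAdj? _ certificate₄ _

theorem3p2 : (l : Fin 4) →
    Σ ℕ (λ n → (n ≤ 10) × RamseyHolds pan3 (pointOrdering pan3 e₃ l) n)
theorem3p2 l = 7 , ℕ.m≤m+n 7 3 , ramseyHolds-pan3-7 l
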